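{- Let $\mathscr{P}_{T_{\mathrm{I}}}$ be the set of partitions $\lambda_1\ge\lambda_2\ge\cdots\ge\lambda_\ell\ge1$ (empty partition included) with $\lambda_i-\lambda_{i+2}\ge 3$ for all applicable $i$, and such that $\lambda_i-\lambda_{i+1}\le 1$ implies $\lambda_i+\lambda_{i+1}\equiv 0\pmod 3$. Let $G(x)=G(x,q)=\sum_{\lambda\in\mathscr{P}_{T_{\mathrm{I}}}}x^{\sharp(\lambda)}q^{|\lambda|}$, where $\sharp(\lambda)$ is the number of parts and $|\lambda|$ the sum of parts. Then $$p_0(x,q)G(x)+p_3(x,q)G(xq^3)+p_6(x,q)G(xq^6)+p_9(x,q)G(xq^9)=0,$$ where \begin{align*} p_0&=1+x(q^4+q^6),\\ p_3&=-1-x(q+q^2+q^3+q^4+q^6)-x^2(q^3+q^4+q^5+2q^6+q^7+q^8+q^9)-x^3(q^7+q^9+q^{10}+q^{12}),\\ p_6&=x^3(q^{11}+q^{13})+x^4(q^{14}+q^{15}+q^{16}+q^{17}+q^{18})+x^5(q^{19}+q^{21}),\\ p_9&=x^5q^{27}+x^6(q^{28}+q^{30}). \end{align*} -}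

module Defs where

open import Data.Bool using (Bool; true; false; _∧_; _∨_; not; if_then_else_)
open import Data.Nat using (ℕ; zero; suc; _+_; _*_; _∸_; _⊓_; _≤?_; _≟_)
open import Data.Nat.Divisibility using (_∣?_)
open import Data.Integer as ℤ using (ℤ; +_; -[1+_])
open import Data.List using (List; []; _∷_; [_]; map; concatMap; applyUpTo; length)
open import Data.Product using (_×_; _,_)
open import Relation.Nullary.Decidable using (⌊_⌋)

-- Partitions are represented as weakly decreasing lists of positive
-- naturals  λ₁ ≥ λ₂ ≥ … ≥ λ_ℓ ≥ 1.

-- partitionsBounded fuel n k : all partitions of n with every part ≤ k,
-- each listed exactly once (fuel ≥ n suffices, since every step removes
-- a part ≥ 1).
partitionsBounded : ℕ → ℕ → ℕ → List (List ℕ)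
partitionsBounded fuel     zero    k = [ [] ]
partitionsBounded zero     (suc n) k = []
partitionsBounded (suc f)  (suc n) k =
  concatMap (λ j → map (j ∷_) (partitionsBounded f (suc n ∸ j) j))
            (applyUpTo suc (k ⊓ suc n))

partitions : ℕ → List (List ℕ)
partitions n = partitionsBounded n n n

adjOK : ℕ → ℕ → Bool
adjOK x y = not ⌊ x ≤? suc y ⌋ ∨ ⌊ 3 ∣? (x + y) ⌋

gapOK : ℕ → ℕ → Bool
gapOK x z = ⌊ z + 3 ≤? x ⌋

isTI : List ℕ → Bool
isTI (x ∷ y ∷ z ∷ r) = adjOK x y ∧ gapOK x z ∧ isTI (y ∷ z ∷ r)
isTI (x ∷ y ∷ [])    = adjOK x y
isTI _               = true

count : {A : Set} → (A → Bool) → List A → ℕ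
count p []       = 0
count p (x ∷ xs) = if p x then suc (count p xs) else count p xs

-- Formal power series in x, q with integer coefficients, given by
-- their coefficient of x^a q^b.

Series : Set
Series = ℕ → ℕ → ℤ

G : Series
G a b = + count (λ l → isTI l ∧ ⌊ length l ≟ a ⌋) (partitions b)

-- F(x q^k) : x^a q^c ↦ x^a q^(c + k a)
subst-xq^ : ℕ → Series → Series
subst-xq^ k F a b = if ⌊ k * a ≤? b ⌋ then F a (b ∸ k * a) else + 0

-- polynomials in x, q : lists of terms  c · x^i q^j  written (c , i , j)
Poly : Set
Poly = List (ℤ × ℕ × ℕ)

_⊙_ : Poly → Series → Series
([] ⊙ F) a b = + 0
(((c , i , j) ∷ P) ⊙ F) a b =
  (if ⌊ i ≤? a ⌋ ∧ ⌊ j ≤? b ⌋ then c ℤ.* F (a ∸ i) (b ∸ j) else + 0)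
  ℤ.+ (P ⊙ F) a b

_⊕_ : Series → Series → Series
(F ⊕ H) a b = F a b ℤ.+ H a b

infixl 7 _⊙_
infixl 6 _⊕_

-1ℤ : ℤ
-1ℤ = -[1+ 0 ]

-2ℤ : ℤ
-2ℤ = -[1+ 1 ]

p₀ : Poly
p₀ = (+ 1 , 0 , 0) ∷ (+ 1 , 1 , 4) ∷ (+ 1 , 1 , 6) ∷ []

p₃ : Poly
p₃ = (-1ℤ , 0 , 0)
   ∷ (-1ℤ , 1 , 1) ∷ (-1ℤ , 1 , 2) ∷ (-1ℤ , 1 , 3) ∷ (-1ℤ , 1 , 4) ∷ (-1ℤ , 1 , 6)
   ∷ (-1ℤ , 2 , 3) ∷ (-1ℤ , 2 , 4) ∷ (-1ℤ , 2 , 5) ∷ (-2ℤ , 2 , 6) ∷ (-1ℤ , 2 , 7)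
   ∷ (-1ℤ , 2 , 8) ∷ (-1ℤ , 2 , 9)
   ∷ (-1ℤ , 3 , 7) ∷ (-1ℤ , 3 , 9) ∷ (-1ℤ , 3 , 10) ∷ (-1ℤ , 3 , 12)
   ∷ []

p₆ : Poly
p₆ = (+ 1 , 3 , 11) ∷ (+ 1 , 3 , 13)
   ∷ (+ 1 , 4 , 14) ∷ (+ 1 , 4 , 15) ∷ (+ 1 , 4 , 16) ∷ (+ 1 , 4 , 17) ∷ (+ 1 , 4 , 18)
   ∷ (+ 1 , 5 , 19) ∷ (+ 1 , 5 , 21)
   ∷ []

p₉ : Poly
p₉ = (+ 1 , 5 , 27) ∷ (+ 1 , 6 , 28) ∷ (+ 1 , 6 , 30) ∷ []

LHS : Series
LHS = p₀ ⊙ G ⊕ p₃ ⊙ subst-xq^ 3 G ⊕ p₆ ⊙ subst-xq^ 6 G ⊕ p₉ ⊙ subst-xq^ 9 G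

module Submission where

-- Let G_{t,τ}(x) = Σ x^{#λ} q^{|λ|} over the partitions
-- λ with parts ≥ t such that λ followed by the fixed tail τ is T_I; G = G_{1,()}.  Then
--   * peeling the smallest part:  G_{t,τ} = G_{t+1,τ} + x q^t G_{t,(t)τ};
--   * junction: below parts ≥ 4 a short tail τ acts as a lower bound m, G_{4,τ} = G_{m,()}
--     (and a tail that is not T_I gives 0);
--   * adding 3 to all parts preserves T_I:  G_{t+3,()}(x) = G_{t,()}(x q³).
-- Peeling until all parts are ≥ 4 gives, for G_t = G_{t,()}, the system
--   G₁ = G₂ + (xq + x²q³) G₁(xq³) + x²q⁴ G₂(xq³),   G₂ = G₃ + xq² G₁(xq³),
--   G₃ = G₁(xq³) + xq³ G₂(xq³) + x²q⁶ G₃(xq³),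
-- and eliminating G₂, G₃ (an explicit combination, checked by normalization) gives the
-- theorem.

open import Defs

module Counting where

  open import Data.Bool using (Bool; true; false; _∧_; if_then_else_)
  open import Data.Bool.Properties using (∧-assoc; ∧-zeroʳ; if-cong; if-cong-then; if-eta)
  open import Data.Nat
  open import Data.Nat.Properties
  open import Data.Nat.Tactic.RingSolver using (solve-∀)
  open import Data.List using (List; []; _∷_; map; concatMap; applyUpTo; length; _++_)
  open import Data.List.Properties using (map-id; map-∘)
  open import Data.Product using (_×_; _,_)
  open import Data.Sum using (inj₁; inj₂)
  open import Data.Unit using (⊤; tt)
  open import Data.Empty using (⊥-elim)
  open import Function using (_∘_)
  open import Relation.Nullary using (Dec; does; yes; no; ¬_)
  open import Relation.Nullary.Decidable using (dec-true; dec-false)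
  open import Relation.Binary.Definitions using (tri<; tri≈; tri>)
  open import Relation.Binary.PropositionalEquality

  Σ< : ℕ → (ℕ → ℕ) → ℕ
  Σ< zero    g = 0
  Σ< (suc r) g = g 0 + Σ< r (g ∘ suc)

  Σ<-cong : ∀ r {g h : ℕ → ℕ} → (∀ i → i < r → g i ≡ h i) → Σ< r g ≡ Σ< r h
  Σ<-cong zero    e = refl
  Σ<-cong (suc r) e = cong₂ _+_ (e 0 z<s) (Σ<-cong r (λ i i<r → e (suc i) (s<s i<r)))

  Σ<-zero : ∀ r {g : ℕ → ℕ} → (∀ i → i < r → g i ≡ 0) → Σ< r g ≡ 0
  Σ<-zero zero    e = refl
  Σ<-zero (suc r) e = cong₂ _+_ (e 0 z<s) (Σ<-zero r (λ i i<r → e (suc i) (s<s i<r)))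

  Σ<-+ : ∀ r (g h : ℕ → ℕ) → Σ< r (λ i → g i + h i) ≡ Σ< r g + Σ< r h
  Σ<-+ zero    g h = refl
  Σ<-+ (suc r) g h = trans (cong (g 0 + h 0 +_) (Σ<-+ r (g ∘ suc) (h ∘ suc)))
                           (interchange (g 0) (h 0) (Σ< r (g ∘ suc)) (Σ< r (h ∘ suc)))
    where
    interchange : ∀ a b c d → a + b + (c + d) ≡ a + c + (b + d)
    interchange = solve-∀

  Σ<-trunc : ∀ {r s} (g : ℕ → ℕ) → r ≤ s → (∀ i → r ≤ i → i < s → g i ≡ 0) → Σ< s g ≡ Σ< r g
  Σ<-trunc {zero}  {s}     g _         e = Σ<-zero s (λ i → e i z≤n)
  Σ<-trunc {suc r} {suc s} g (s≤s r≤s) e =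
    cong (g 0 +_) (Σ<-trunc (g ∘ suc) r≤s (λ i r≤i i<s → e (suc i) (s≤s r≤i) (s<s i<s)))

  Σ<-last : ∀ n (g : ℕ → ℕ) → (∀ i → i < n → g i ≡ 0) → Σ< (suc n) g ≡ g n
  Σ<-last zero    g _ = +-identityʳ (g 0)
  Σ<-last (suc n) g e = trans (cong (_+ Σ< (suc n) (g ∘ suc)) (e 0 z<s))
                              (Σ<-last n (g ∘ suc) (λ i i<n → e (suc i) (s<s i<n)))

  count-++ : ∀ {A : Set} (p : A → Bool) xs ys → count p (xs ++ ys) ≡ count p xs + count p ys
  count-++ p []       ys = refl
  count-++ p (x ∷ xs) ys with p x
  ... | true  = cong suc (count-++ p xs ys)
  ... | false = count-++ p xs ys

  count-map : ∀ {A B : Set} (p : B → Bool) (f : A → B) xs → count p (map f xs) ≡ count (p ∘ f) xs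
  count-map p f []       = refl
  count-map p f (x ∷ xs) with p (f x)
  ... | true  = cong suc (count-map p f xs)
  ... | false = count-map p f xs

  count-concatMap : ∀ {B : Set} (p : B → Bool) (h : ℕ → List B) (g : ℕ → ℕ) r →
    count p (concatMap h (applyUpTo g r)) ≡ Σ< r (λ i → count p (h (g i)))
  count-concatMap p h g zero    = refl
  count-concatMap p h g (suc r) = trans (count-++ p (h (g 0)) _)
    (cong (count p (h (g 0)) +_) (count-concatMap p h (g ∘ suc) r))

  -- N p f n k is the number of members of  partitionsBounded f n k  satisfying p,
  -- computed by the same recursion on the first (largest) part  suc i.
  N : (List ℕ → Bool) → ℕ → ℕ → ℕ → ℕ
  N p f       zero    k = if p [] then 1 else 0
  N p zero    (suc n) k = 0
  N p (suc f) (suc n) k = Σ< (k ⊓ suc n) (λ i → N (λ l → p (suc i ∷ l)) f (n ∸ i) (suc i))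

  count-partitionsBounded : ∀ p f n k → count p (partitionsBounded f n k) ≡ N p f n k
  count-partitionsBounded p f       zero    k with p []
  ... | true  = refl
  ... | false = refl
  count-partitionsBounded p zero    (suc n) k = refl
  count-partitionsBounded p (suc f) (suc n) k =
    trans (count-concatMap p (λ j → map (j ∷_) (partitionsBounded f (suc n ∸ j) j)) suc (k ⊓ suc n))
          (Σ<-cong (k ⊓ suc n) (λ i _ →
            trans (count-map p (suc i ∷_) (partitionsBounded f (n ∸ i) (suc i)))
                  (count-partitionsBounded (λ l → p (suc i ∷ l)) f (n ∸ i) (suc i))))

  N-fuel : ∀ p f f′ n k → n ≤ f → n ≤ f′ → N p f n k ≡ N p f′ n k
  N-fuel p f       f′       zero    k _         _          = refl
  N-fuel p (suc f) (suc f′) (suc n) k (s≤s n≤f) (s≤s n≤f′) =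
    Σ<-cong (k ⊓ suc n) (λ i _ → N-fuel _ f f′ (n ∸ i) (suc i)
      (≤-trans (m∸n≤m n i) n≤f) (≤-trans (m∸n≤m n i) n≤f′))

  N-bound : ∀ p f n k → n ≤ k → N p f n k ≡ N p f n n
  N-bound p f       zero    k _   = refl
  N-bound p zero    (suc n) k _   = refl
  N-bound p (suc f) (suc n) k n≤k = cong (λ r → Σ< r _) (trans (m≥n⇒m⊓n≡n n≤k) (sym (⊓-idem (suc n))))

  N-canonical : ∀ p f n k → n ≤ f → n ≤ k → N p f n k ≡ N p n n n
  N-canonical p f n k n≤f n≤k = trans (N-fuel p f n n k n≤f ≤-refl) (N-bound p n n k n≤k)

  -- Decreasing k l: l is weakly decreasing with parts in [1, k], the shape of every
  -- list enumerated by  partitionsBounded _ _ k.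
  Decreasing : ℕ → List ℕ → Set
  Decreasing k []      = ⊤
  Decreasing k (x ∷ l) = (1 ≤ x × x ≤ k) × Decreasing x l

  N-cong : ∀ p p′ f n k → (∀ l → Decreasing k l → p l ≡ p′ l) → N p f n k ≡ N p′ f n k
  N-cong p p′ f       zero    k e rewrite e [] tt = refl
  N-cong p p′ zero    (suc n) k e = refl
  N-cong p p′ (suc f) (suc n) k e =
    Σ<-cong (k ⊓ suc n) (λ i i< → N-cong _ _ f (n ∸ i) (suc i)
      (λ l d → e (suc i ∷ l) ((s≤s z≤n , m<n⊓o⇒m<n k (suc n) i<) , d)))

  N-false : ∀ p f n k → (∀ l → p l ≡ false) → N p f n k ≡ 0
  N-false p f       zero    k e rewrite e [] = refl
  N-false p zero    (suc n) k e = refl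
  N-false p (suc f) (suc n) k e =
    Σ<-zero (k ⊓ suc n) (λ i _ → N-false _ f (n ∸ i) (suc i) (λ l → e (suc i ∷ l)))

  N-guard : ∀ c p f n k → N (λ l → c ∧ p l) f n k ≡ (if c then N p f n k else 0)
  N-guard true  p f n k = refl
  N-guard false p f n k = N-false _ f n k (λ _ → refl)

  ≤ᵇ-true : ∀ {m n} → m ≤ n → (m ≤ᵇ n) ≡ true
  ≤ᵇ-true {m} {n} = dec-true (m ≤? n)

  ≤ᵇ-false : ∀ {m n} → n < m → (m ≤ᵇ n) ≡ false
  ≤ᵇ-false {m} {n} n<m = dec-false (m ≤? n) (<⇒≱ n<m)

  does-iff : ∀ {A B : Set} (d : Dec A) (e : Dec B) → (A → B) → (B → A) → does d ≡ does e
  does-iff (yes a) (yes b) _  _    = refl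
  does-iff (yes a) (no ¬b) to _    = ⊥-elim (¬b (to a))
  does-iff (no ¬a) (yes b) _  from = ⊥-elim (¬a (from b))
  does-iff (no ¬a) (no ¬b) _  _    = refl

  ≤ᵇ-iff : ∀ {m n m′ n′} → (m ≤ n → m′ ≤ n′) → (m′ ≤ n′ → m ≤ n) → (m ≤ᵇ n) ≡ (m′ ≤ᵇ n′)
  ≤ᵇ-iff {m} {n} {m′} {n′} = does-iff (m ≤? n) (m′ ≤? n′)

  all≥ : ℕ → List ℕ → Bool
  all≥ t []      = true
  all≥ t (x ∷ l) = (t ≤ᵇ x) ∧ all≥ t l

  Restr : ℕ → (List ℕ → Bool) → ℕ → List ℕ → Bool
  Restr t R a l = all≥ t l ∧ (R l ∧ (length l ≡ᵇ a))

  Restr-cons : ∀ s R a j l → Restr s R (suc a) (j ∷ l) ≡ (s ≤ᵇ j) ∧ Restr s (λ l′ → R (j ∷ l′)) a l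
  Restr-cons s R a j l = ∧-assoc (s ≤ᵇ j) (all≥ s l) _

  N-cons : ∀ s R a f n k j →
    N (λ l → Restr s R (suc a) (j ∷ l)) f n k ≡ (if s ≤ᵇ j then N (Restr s (λ l → R (j ∷ l)) a) f n k else 0)
  N-cons s R a f n k j = trans (N-cong _ _ f n k (λ l _ → Restr-cons s R a j l)) (N-guard (s ≤ᵇ j) _ f n k)

  N-cons-below : ∀ s R a f n k j → j < s → N (λ l → Restr s R a (j ∷ l)) f n k ≡ 0
  N-cons-below s R a f n k j j<s = N-false _ f n k (λ l → cong (_∧ _) (cong (_∧ all≥ s l) (≤ᵇ-false j<s)))

  N-cons-no-parts : ∀ s R f n k j → N (λ l → Restr s R 0 (j ∷ l)) f n k ≡ 0
  N-cons-no-parts s R f n k j = N-false _ f n k (λ l →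
    trans (cong (all≥ s (j ∷ l) ∧_) (∧-zeroʳ (R (j ∷ l)))) (∧-zeroʳ _))

  N-no-parts : ∀ t R f n k → N (Restr t R 0) f (suc n) k ≡ 0
  N-no-parts t R zero    n k = refl
  N-no-parts t R (suc f) n k = Σ<-zero (k ⊓ suc n) (λ i _ → N-cons-no-parts t R f (n ∸ i) (suc i) (suc i))

  N-above-bound : ∀ T R a f m → N (Restr (suc T) R a) f (suc m) T ≡ 0
  N-above-bound T R a zero    m = refl
  N-above-bound T R a (suc f) m = Σ<-zero (T ⊓ suc m) (λ i i< →
    N-cons-below (suc T) R a f (m ∸ i) (suc i) (suc i) (s≤s (m<n⊓o⇒m<n T (suc m) i<)))

  N-too-small : ∀ f s a m k R → m < s * a → N (Restr s R a) f m k ≡ 0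
  N-too-small f s zero m k R m<s*0 = ⊥-elim (n≮0 (subst (m <_) (*-zeroʳ s) m<s*0))
  N-too-small f s (suc a) zero k R _ = cong (λ b → if b then 1 else 0) (∧-zeroʳ (R []))
  N-too-small zero s (suc a) (suc m) k R _ = refl
  N-too-small (suc f) s (suc a) (suc m) k R m<s*a =
    Σ<-zero (k ⊓ suc m) (λ i i< → trans (N-cons s R a f (m ∸ i) (suc i) (suc i)) (first-part i (≤-pred (m<n⊓o⇒m<o k (suc m) i<))))
    where
    first-part : ∀ i → i ≤ m → (if s ≤ᵇ suc i then N (Restr s (λ l → R (suc i ∷ l)) a) f (m ∸ i) (suc i) else 0) ≡ 0
    first-part i i≤m with s ≤? suc i
    ... | no s≰ = if-cong (dec-false (s ≤? suc i) s≰)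
    ... | yes s≤ = trans (if-cong (≤ᵇ-true s≤))
      (N-too-small f s a (m ∸ i) (suc i) _ (+-cancelˡ-< s (m ∸ i) (s * a) (begin-strict
        s + (m ∸ i)     ≤⟨ +-monoˡ-≤ (m ∸ i) s≤ ⟩
        suc i + (m ∸ i) ≡⟨ cong suc (m+[n∸m]≡n i≤m) ⟩
        suc m           <⟨ m<s*a ⟩
        s * suc a       ≡⟨ *-suc s a ⟩
        s + s * a       ∎)))
      where open ≤-Reasoning

  snoc : (List ℕ → Bool) → ℕ → List ℕ → Bool
  snoc R t l = R (l ++ t ∷ [])

  -- Qf f n k t a R: the partitions counted by  N (Restr t R a) f n k  whose smallest part
  -- is t, counted by what remains after removing that part, a partition of n ∸ t into
  -- a - 1 parts ≥ t which satisfies R once t is appended.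
  Qf : ℕ → ℕ → ℕ → ℕ → ℕ → (List ℕ → Bool) → ℕ
  Qf f n k t zero    R = 0
  Qf f n k t (suc a) R = if t ≤ᵇ n then N (Restr t (snoc R t) a) f (n ∸ t) k else 0

  -- Peeling the smallest part: a partition with parts ≥ t either has all parts ≥ t + 1
  -- or ends in t.  Peel f is this statement for fuel f.
  Peel : ℕ → Set
  Peel f = ∀ n k t a R → 1 ≤ t → t ≤ k → n ≤ f →
    N (Restr t R a) f n k ≡ N (Restr (suc t) R a) f n k + Qf f n k t a R

  ≤∸⇒+≤ : ∀ a n i → 1 ≤ a → a ≤ n ∸ i → a + i ≤ n
  ≤∸⇒+≤ a n i 1≤a a≤n∸i with i ≤? n
  ... | yes i≤n = m≤o∸n⇒m+n≤o a i≤n a≤n∸i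
  ... | no  i≰n = ⊥-elim (<⇒≱ 1≤a (subst (a ≤_) (m≤n⇒m∸n≡0 (<⇒≤ (≰⇒> i≰n))) a≤n∸i))

  -- The peeling step for partitions of  2 + t + m  into parts in [1 + t, k], by cases
  -- on the first part  1 + i  (given the statement for smaller fuel).
  module PeelStep (f t m k : ℕ) (R : List ℕ → Bool) (IH : Peel f) (t<k : t < k) (fuel : suc (t + m) ≤ f) where

    n : ℕ
    n = suc (t + m)

    R⁺ : ℕ → List ℕ → Bool
    R⁺ i l = R (suc i ∷ l)

    -- contributions of the first part 1 + i to the three counts of the peeling identity
    L F Qs Z : ℕ → ℕ → ℕ
    L  a i = N (λ l → Restr (suc t) R (suc a) (suc i ∷ l)) f (n ∸ i) (suc i)
    F  a i = N (λ l → Restr (suc (suc t)) R (suc a) (suc i ∷ l)) f (n ∸ i) (suc i)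
    Qs a i = N (λ l → Restr (suc t) (snoc R (suc t)) a (suc i ∷ l)) f (m ∸ i) (suc i)
    Z  a i = if suc i ≤ᵇ k ⊓ suc m then Qs a i else 0

    n∸t : n ∸ t ≡ suc m
    n∸t = trans (cong (_∸ t) (sym (+-suc t m))) (m+n∸m≡n t (suc m))

    rest-size : ∀ i → n ∸ i ∸ suc t ≡ m ∸ i
    rest-size i = begin
      n ∸ i ∸ suc t   ≡⟨ ∸-+-assoc n i (suc t) ⟩
      n ∸ (i + suc t) ≡⟨ cong (n ∸_) (+-comm i (suc t)) ⟩
      n ∸ (suc t + i) ≡⟨ [m+n]∸[m+o]≡n∸o t m i ⟩
      m ∸ i           ∎
      where open ≡-Reasoning

    -- after a first part 1 + i < 1 + k there is room for a last part 1 + t exactly when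
    -- 1 + i is an admissible first part of the remaining partition of 1 + m
    room-for-t : ∀ i → i < k → (suc t ≤ᵇ n ∸ i) ≡ (suc i ≤ᵇ k ⊓ suc m)
    room-for-t i i<k = ≤ᵇ-iff
      (λ h → ⊓-glb i<k (s≤s (+-cancelˡ-≤ t i m (≤-pred (≤∸⇒+≤ (suc t) n i (s≤s z≤n) h)))))
      (λ h → m+n≤o⇒m≤o∸n (suc t) (s≤s (+-monoʳ-≤ t (≤-pred (m<n⊓o⇒m<o k (suc m) h)))))

    below : ∀ a i → i < t → L a i ≡ F a i + Z a i
    below a i i<t = begin
      L a i          ≡⟨ N-cons-below (suc t) R (suc a) f (n ∸ i) (suc i) (suc i) (s≤s i<t) ⟩
      0              ≡⟨ sym (cong₂ _+_ F0 Z0) ⟩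
      F a i + Z a i  ∎
      where
      open ≡-Reasoning
      F0 : F a i ≡ 0
      F0 = N-cons-below (suc (suc t)) R (suc a) f (n ∸ i) (suc i) (suc i) (s≤s (m≤n⇒m≤1+n i<t))
      Z0 : Z a i ≡ 0
      Z0 = trans (if-cong-then (suc i ≤ᵇ k ⊓ suc m) (N-cons-below (suc t) (snoc R (suc t)) a f (m ∸ i) (suc i) (suc i) (s≤s i<t)))
                 (if-eta (suc i ≤ᵇ k ⊓ suc m))

    F-match : ∀ a i → t ≤ i → N (Restr (suc (suc t)) (R⁺ i) a) f (n ∸ i) (suc i) ≡ F a i
    F-match a i t≤i with m≤n⇒m<n∨m≡n t≤i
    ... | inj₁ t<i  = sym (trans (N-cons (suc (suc t)) R a f (n ∸ i) (suc i) (suc i)) (if-cong (≤ᵇ-true (s≤s t<i))))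
    ... | inj₂ refl = begin
      N (Restr (suc (suc t)) (R⁺ t) a) f (n ∸ t) (suc t) ≡⟨ cong (λ s → N (Restr (suc (suc t)) (R⁺ t) a) f s (suc t)) n∸t ⟩
      N (Restr (suc (suc t)) (R⁺ t) a) f (suc m) (suc t) ≡⟨ N-above-bound (suc t) (R⁺ t) a f m ⟩
      0                                                   ≡⟨ sym (N-cons-below (suc (suc t)) R (suc a) f (n ∸ t) (suc t) (suc t) ≤-refl) ⟩
      F a t                                               ∎
      where open ≡-Reasoning

    Z-match : ∀ a i → t ≤ i → i < k → Qf f (n ∸ i) (suc i) (suc t) a (R⁺ i) ≡ Z a i
    Z-match zero    i _   _   = sym (trans
      (if-cong-then (suc i ≤ᵇ k ⊓ suc m) (N-cons-no-parts (suc t) (snoc R (suc t)) f (m ∸ i) (suc i) (suc i)))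
      (if-eta (suc i ≤ᵇ k ⊓ suc m)))
    Z-match (suc a) i t≤i i<k = cong₂ (λ c x → if c then x else 0) (room-for-t i i<k) (begin
      N (Restr (suc t) (snoc (R⁺ i) (suc t)) a) f (n ∸ i ∸ suc t) (suc i)
        ≡⟨ cong (λ s → N (Restr (suc t) (snoc (R⁺ i) (suc t)) a) f s (suc i)) (rest-size i) ⟩
      N (Restr (suc t) (snoc (R⁺ i) (suc t)) a) f (m ∸ i) (suc i)
        ≡⟨ sym (trans (N-cons (suc t) (snoc R (suc t)) a f (m ∸ i) (suc i) (suc i)) (if-cong (≤ᵇ-true (s≤s t≤i)))) ⟩
      Qs (suc a) i ∎)
      where open ≡-Reasoning

    above : ∀ a i → t ≤ i → i < k → L a i ≡ F a i + Z a i
    above a i t≤i i<k = begin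
      L a i ≡⟨ trans (N-cons (suc t) R a f (n ∸ i) (suc i) (suc i)) (if-cong (≤ᵇ-true (s≤s t≤i))) ⟩
      N (Restr (suc t) (R⁺ i) a) f (n ∸ i) (suc i)
        ≡⟨ IH (n ∸ i) (suc i) (suc t) a (R⁺ i) (s≤s z≤n) (s≤s t≤i) (≤-trans (m∸n≤m n i) fuel) ⟩
      N (Restr (suc (suc t)) (R⁺ i) a) f (n ∸ i) (suc i) + Qf f (n ∸ i) (suc i) (suc t) a (R⁺ i)
        ≡⟨ cong₂ _+_ (F-match a i t≤i) (Z-match a i t≤i i<k) ⟩
      F a i + Z a i ∎
      where open ≡-Reasoning

    per-part : ∀ a i → i < k ⊓ suc n → L a i ≡ F a i + Z a i
    per-part a i i< with t ≤? i
    ... | yes t≤i = above a i t≤i (m<n⊓o⇒m<n k (suc n) i<)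
    ... | no  t≰i = below a i (≰⇒> t≰i)

    Z-sum : ∀ a → Σ< (k ⊓ suc n) (Z a) ≡ Σ< (k ⊓ suc m) (Qs a)
    Z-sum a = trans
      (Σ<-trunc (Z a) (⊓-monoʳ-≤ k (s≤s (m≤n⇒m≤1+n (m≤n+m m t)))) (λ i r≤i _ → if-cong (≤ᵇ-false (s≤s r≤i))))
      (Σ<-cong (k ⊓ suc m) (λ i i< → if-cong (≤ᵇ-true i<)))

    Qf-expand : ∀ a → Qf (suc f) (suc n) k (suc t) (suc a) R ≡ Σ< (k ⊓ suc m) (Qs a)
    Qf-expand a = trans (if-cong (≤ᵇ-true (s≤s (m≤n⇒m≤1+n (m≤m+n t m)))))
                        (cong (λ s → N (Restr (suc t) (snoc R (suc t)) a) (suc f) s k) n∸t)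

    step : ∀ a → N (Restr (suc t) R (suc a)) (suc f) (suc n) k
               ≡ N (Restr (suc (suc t)) R (suc a)) (suc f) (suc n) k + Qf (suc f) (suc n) k (suc t) (suc a) R
    step a = begin
      Σ< r (L a)                     ≡⟨ Σ<-cong r (per-part a) ⟩
      Σ< r (λ i → F a i + Z a i)     ≡⟨ Σ<-+ r (F a) (Z a) ⟩
      Σ< r (F a) + Σ< r (Z a)        ≡⟨ cong (Σ< r (F a) +_) (trans (Z-sum a) (sym (Qf-expand a))) ⟩
      Σ< r (F a) + Qf (suc f) (suc n) k (suc t) (suc a) R ∎
      where
      open ≡-Reasoning
      r = k ⊓ suc n

  -- The peeling identity for a partition of exactly 1 + t with parts ≥ 1 + t: it is [1 + t].
  peel-exact : ∀ f t k a R → t < k →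
    N (Restr (suc t) R (suc a)) (suc f) (suc t) k
      ≡ N (Restr (suc (suc t)) R (suc a)) (suc f) (suc t) k + Qf (suc f) (suc t) k (suc t) (suc a) R
  peel-exact f t k a R t<k = begin
    Σ< (k ⊓ suc t) L   ≡⟨ cong (λ r → Σ< r L) (m≥n⇒m⊓n≡n t<k) ⟩
    Σ< (suc t) L       ≡⟨ Σ<-last t L (λ i i<t → N-cons-below (suc t) R (suc a) f (t ∸ i) (suc i) (suc i) (s≤s i<t)) ⟩
    L t                ≡⟨ single-part ⟩
    Qf (suc f) (suc t) k (suc t) (suc a) R
                       ≡⟨ cong (_+ Qf (suc f) (suc t) k (suc t) (suc a) R) (sym no-larger) ⟩
    Σ< (k ⊓ suc t) F + Qf (suc f) (suc t) k (suc t) (suc a) R ∎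
    where
    open ≡-Reasoning
    L F : ℕ → ℕ
    L i = N (λ l → Restr (suc t) R (suc a) (suc i ∷ l)) f (t ∸ i) (suc i)
    F i = N (λ l → Restr (suc (suc t)) R (suc a) (suc i ∷ l)) f (t ∸ i) (suc i)
    no-larger : Σ< (k ⊓ suc t) F ≡ 0
    no-larger = Σ<-zero (k ⊓ suc t) (λ i i< →
      N-cons-below (suc (suc t)) R (suc a) f (t ∸ i) (suc i) (suc i) (s≤s (m<n⊓o⇒m<o k (suc t) i<)))
    single-part : L t ≡ Qf (suc f) (suc t) k (suc t) (suc a) R
    single-part rewrite n∸n≡0 t | ≤ᵇ-true (≤-refl {suc t}) = refl

  -- No part can be as large as 1 + t when the partitioned number is smaller.
  peel-too-big : ∀ f n k t a R → n < t →
    N (Restr (suc t) R a) (suc f) (suc n) k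
      ≡ N (Restr (suc (suc t)) R a) (suc f) (suc n) k + Qf (suc f) (suc n) k (suc t) a R
  peel-too-big f n k t a R n<t = begin
    N (Restr (suc t) R a) (suc f) (suc n) k
      ≡⟨ Σ<-zero (k ⊓ suc n) (λ i i< → N-cons-below (suc t) R a f (n ∸ i) (suc i) (suc i) (part<t i i<)) ⟩
    0
      ≡⟨ sym (Σ<-zero (k ⊓ suc n) (λ i i< → N-cons-below (suc (suc t)) R a f (n ∸ i) (suc i) (suc i) (m<n⇒m<1+n (part<t i i<)))) ⟩
    N (Restr (suc (suc t)) R a) (suc f) (suc n) k
      ≡⟨ sym (+-identityʳ _) ⟩
    N (Restr (suc (suc t)) R a) (suc f) (suc n) k + 0
      ≡⟨ cong (N (Restr (suc (suc t)) R a) (suc f) (suc n) k +_) (sym (no-room a)) ⟩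
    N (Restr (suc (suc t)) R a) (suc f) (suc n) k + Qf (suc f) (suc n) k (suc t) a R ∎
    where
    open ≡-Reasoning
    part<t : ∀ i → i < k ⊓ suc n → suc i < suc t
    part<t i i< = s≤s (<-≤-trans (m<n⊓o⇒m<o k (suc n) i<) n<t)
    no-room : ∀ a → Qf (suc f) (suc n) k (suc t) a R ≡ 0
    no-room zero    = refl
    no-room (suc a) = if-cong (≤ᵇ-false (s≤s n<t))

  peel : ∀ f → Peel f
  peel f       zero    k (suc t) zero    R _ _ _ = sym (+-identityʳ _)
  peel f       zero    k (suc t) (suc a) R _ _ _ = sym (+-identityʳ _)
  peel zero    (suc n) k t       a       R _ _ ()
  peel (suc f) (suc n) k (suc t) zero    R _ _ _ =
    trans (N-no-parts (suc t) R (suc f) n k) (sym (trans (+-identityʳ _) (N-no-parts (suc (suc t)) R (suc f) n k)))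
  peel (suc f) (suc n) k (suc t) (suc a) R _ t<k (s≤s n≤f) with <-cmp t n
  ... | tri> _ _ n<t  = peel-too-big f n k t (suc a) R n<t
  ... | tri≈ _ refl _ = peel-exact f t k a R t<k
  ... | tri< t<n _ _ with n ∸ suc t | m+[n∸m]≡n t<n
  ...   | m | refl = PeelStep.step f t m k R (peel f) t<k n≤f a

  -- A first part 2 + j with j ≥ n leaves less than a for the remaining a parts ≥ 2 + t.
  N-cons-overfull : ∀ f t a n j R → n ≤ j → suc j ≤ a + n →
    N (λ l → Restr (suc (suc t)) R (suc a) (suc (suc j) ∷ l)) f ((a + n) ∸ suc j) (suc (suc j)) ≡ 0
  N-cons-overfull f t a n j R n≤j sj≤ =
    trans (N-cons (suc (suc t)) R a f ((a + n) ∸ suc j) (suc (suc j)) (suc (suc j)))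
      (trans (if-cong-then guard (N-too-small f (suc (suc t)) a ((a + n) ∸ suc j) (suc (suc j)) (λ l → R (suc (suc j) ∷ l))
                (<-≤-trans leftover<a (m≤m+n a (suc t * a)))))
             (if-eta guard))
    where
    guard = suc (suc t) ≤ᵇ suc (suc j)
    leftover<a : (a + n) ∸ suc j < a
    leftover<a = +-cancelʳ-< (suc j) _ a (subst (_< a + suc j) (sym (m∸n+n≡m sj≤)) (+-monoʳ-< a (s≤s n≤j)))

  shift-one : ∀ f a n k t R → a + n ≤ f →
    N (Restr (suc (suc t)) R a) f (a + n) (suc k) ≡ N (Restr (suc t) (λ l → R (map suc l)) a) f n k
  shift-one f       zero    zero    k t R _ = refl
  shift-one f       zero    (suc n) k t R _ = trans (N-no-parts (suc (suc t)) R f n (suc k)) (sym (N-no-parts (suc t) _ f n k))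
  shift-one (suc f) (suc a) n       k t R (s≤s a+n≤f) =
    trans (cong (_+ Σ< (k ⊓ (a + n)) T) first-part-one) (trans (+-identityˡ _) (rest n refl))
    where
    R′ : List ℕ → Bool
    R′ l = R (map suc l)
    T : ℕ → ℕ
    T j = N (λ l → Restr (suc (suc t)) R (suc a) (suc (suc j) ∷ l)) f ((a + n) ∸ suc j) (suc (suc j))
    first-part-one : N (λ l → Restr (suc (suc t)) R (suc a) (1 ∷ l)) f (a + n) 1 ≡ 0
    first-part-one = N-cons-below (suc (suc t)) R (suc a) f (a + n) 1 1 (s≤s (s≤s z≤n))
    T-vanish : ∀ j → n ≤ j → suc j ≤ a + n → T j ≡ 0
    T-vanish j = N-cons-overfull f t a n j R
    rest : ∀ n′ → n ≡ n′ → Σ< (k ⊓ (a + n)) T ≡ N (Restr (suc t) R′ (suc a)) (suc f) n′ k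
    rest zero refl = trans (Σ<-zero (k ⊓ (a + 0)) (λ j j< → T-vanish j z≤n (m<n⊓o⇒m<o k (a + 0) j<)))
      (sym (if-cong (∧-zeroʳ (R []))))
    rest (suc n′) refl = trans
      (Σ<-trunc T (⊓-monoʳ-≤ k (m≤n+m (suc n′) a)) (λ j r≤j j<r → T-vanish j (beyond j r≤j j<r) (m<n⊓o⇒m<o k (a + suc n′) j<r)))
      (Σ<-cong (k ⊓ suc n′) (λ j j< → T-match j (≤-pred (m<n⊓o⇒m<o k (suc n′) j<))))
      where
      beyond : ∀ j → k ⊓ suc n′ ≤ j → j < k ⊓ (a + suc n′) → suc n′ ≤ j
      beyond j r≤j j<r with suc n′ ≤? j
      ... | yes p = p
      ... | no ¬p = ⊥-elim (<⇒≱ (⊓-glb (m<n⊓o⇒m<n k (a + suc n′) j<r) (≰⇒> ¬p)) r≤j)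
      T-match : ∀ j → j ≤ n′ → T j ≡ N (λ l → Restr (suc t) R′ (suc a) (suc j ∷ l)) f (n′ ∸ j) (suc j)
      T-match j j≤n′ = begin
        T j ≡⟨ N-cons (suc (suc t)) R a f ((a + suc n′) ∸ suc j) (suc (suc j)) (suc (suc j)) ⟩
        (if suc t ≤ᵇ suc j then N (Restr (suc (suc t)) (λ l → R (suc (suc j) ∷ l)) a) f ((a + suc n′) ∸ suc j) (suc (suc j)) else 0)
          ≡⟨ if-cong-then (suc t ≤ᵇ suc j) (trans
               (cong (λ s → N (Restr (suc (suc t)) (λ l → R (suc (suc j) ∷ l)) a) f s (suc (suc j))) (+-∸-assoc a (s≤s j≤n′)))
               (shift-one f a (n′ ∸ j) (suc j) t _ (≤-trans (+-monoʳ-≤ a (m∸n≤m n′ j)) (≤-trans (+-monoʳ-≤ a (n≤1+n n′)) a+n≤f)))) ⟩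
        (if suc t ≤ᵇ suc j then N (Restr (suc t) (λ l → R′ (suc j ∷ l)) a) f (n′ ∸ j) (suc j) else 0)
          ≡⟨ sym (N-cons (suc t) R′ a f (n′ ∸ j) (suc j) (suc j)) ⟩
        N (λ l → Restr (suc t) R′ (suc a) (suc j ∷ l)) f (n′ ∸ j) (suc j) ∎
        where open ≡-Reasoning

  shift : ∀ d f a n k t R → d * a + n ≤ f →
    N (Restr (suc (d + t)) R a) f (d * a + n) (d + k) ≡ N (Restr (suc t) (λ l → R (map (d +_) l)) a) f n k
  shift zero    f a n k t R _    = N-cong _ _ f n k (λ l _ → cong (λ l′ → all≥ (suc t) l ∧ (R l′ ∧ (length l ≡ᵇ a))) (sym (map-id l)))
  shift (suc d) f a n k t R fuel = begin
    N (Restr (suc (suc (d + t))) R a) f ((a + d * a) + n) (suc (d + k))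
      ≡⟨ cong (λ s → N (Restr (suc (suc (d + t))) R a) f s (suc (d + k))) (+-assoc a (d * a) n) ⟩
    N (Restr (suc (suc (d + t))) R a) f (a + (d * a + n)) (suc (d + k))
      ≡⟨ shift-one f a (d * a + n) (d + k) (d + t) R (subst (_≤ f) (+-assoc a (d * a) n) fuel) ⟩
    N (Restr (suc (d + t)) (λ l → R (map suc l)) a) f (d * a + n) (d + k)
      ≡⟨ shift d f a n k t _ (≤-trans (m≤n+m (d * a + n) a) (subst (_≤ f) (+-assoc a (d * a) n) fuel)) ⟩
    N (Restr (suc t) (λ l → R (map suc (map (d +_) l))) a) f n k
      ≡⟨ N-cong _ _ f n k (λ l _ → cong (λ l′ → all≥ (suc t) l ∧ (R l′ ∧ (length l ≡ᵇ a))) (sym (map-∘ l))) ⟩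
    N (Restr (suc t) (λ l → R (map (suc d +_) l)) a) f n k ∎
    where open ≡-Reasoning


module TI where

  open Counting
  open import Data.Bool using (Bool; true; false; _∧_; _∨_; not)
  open import Data.Bool.Properties using (∧-identityʳ; ∧-zeroʳ)
  import Data.Bool.Properties as Bool
  open import Data.Nat
  open import Data.Nat.Properties
  open import Data.Nat.Divisibility using (_∣_; _∣?_; ∣m∣n⇒∣m+n; ∣m+n∣m⇒∣n; divides)
  open import Data.Nat.Tactic.RingSolver using (solve-∀)
  open import Data.List using (List; []; _∷_; map; _++_)
  open import Data.List.Relation.Unary.All as All using (All; []; _∷_)
  open import Data.Product using (_×_; _,_)
  open import Relation.Nullary using (Dec; yes; no; ¬_)
  open import Relation.Nullary.Decidable using (⌊_⌋; isYes≗does; dec-true; dec-false; _×-dec_; _→-dec_; True; toWitness)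
  open import Relation.Binary.PropositionalEquality

  ⌊⌋-true : ∀ {A : Set} (d : Dec A) → A → ⌊ d ⌋ ≡ true
  ⌊⌋-true d a = trans (isYes≗does d) (dec-true d a)

  ⌊⌋-false : ∀ {A : Set} (d : Dec A) → ¬ A → ⌊ d ⌋ ≡ false
  ⌊⌋-false d ¬a = trans (isYes≗does d) (dec-false d ¬a)

  ⌊⌋-iff : ∀ {A B : Set} (d : Dec A) (e : Dec B) → (A → B) → (B → A) → ⌊ d ⌋ ≡ ⌊ e ⌋
  ⌊⌋-iff d e to from = trans (isYes≗does d) (trans (does-iff d e to from) (sym (isYes≗does e)))

  -- Adding 3 to two parts preserves their difference and their sum modulo 3.
  adjOK-+3 : ∀ x y → adjOK (3 + x) (3 + y) ≡ adjOK x y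
  adjOK-+3 x y = cong₂ (λ u v → not u ∨ v)
    (⌊⌋-iff ((3 + x) ≤? suc (3 + y)) (x ≤? suc y) (+-cancelˡ-≤ 3 _ _) (+-monoʳ-≤ 3))
    (⌊⌋-iff (3 ∣? ((3 + x) + (3 + y))) (3 ∣? (x + y))
      (λ d → ∣m+n∣m⇒∣n (subst (3 ∣_) (sum+6 x y) d) (divides 2 refl))
      (λ d → subst (3 ∣_) (sym (sum+6 x y)) (∣m∣n⇒∣m+n (divides 2 refl) d)))
    where
    sum+6 : ∀ x y → (3 + x) + (3 + y) ≡ 6 + (x + y)
    sum+6 = solve-∀

  gapOK-+3 : ∀ x z → gapOK (3 + x) (3 + z) ≡ gapOK x z
  gapOK-+3 x z = ⌊⌋-iff ((3 + z) + 3 ≤? 3 + x) (z + 3 ≤? x) (+-cancelˡ-≤ 3 _ _) (+-monoʳ-≤ 3)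

  isTI-map3 : ∀ l → isTI (map (3 +_) l) ≡ isTI l
  isTI-map3 []              = refl
  isTI-map3 (x ∷ [])        = refl
  isTI-map3 (x ∷ y ∷ [])    = adjOK-+3 x y
  isTI-map3 (x ∷ y ∷ z ∷ r) = cong₂ _∧_ (adjOK-+3 x y) (cong₂ _∧_ (gapOK-+3 x z) (isTI-map3 (y ∷ z ∷ r)))

  isTI-cons-false : ∀ x m → isTI m ≡ false → isTI (x ∷ m) ≡ false
  isTI-cons-false x (y ∷ z ∷ r) e rewrite e = trans (cong (adjOK x y ∧_) (∧-zeroʳ (gapOK x z))) (∧-zeroʳ (adjOK x y))

  isTI-suffix : ∀ l τ → isTI τ ≡ false → isTI (l ++ τ) ≡ false
  isTI-suffix []      τ e = e
  isTI-suffix (x ∷ l) τ e = isTI-cons-false x (l ++ τ) (isTI-suffix l τ e)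

  adjOK-far : ∀ x y → suc (suc y) ≤ x → adjOK x y ≡ true
  adjOK-far x y h = cong (λ b → not b ∨ ⌊ 3 ∣? (x + y) ⌋) (⌊⌋-false (x ≤? suc y) (<⇒≱ h))

  gapOK-far : ∀ x z → z + 3 ≤ x → gapOK x z ≡ true
  gapOK-far x z = ⌊⌋-true (z + 3 ≤? x)

  far-enough : ∀ {x} t → t + 3 ≤ x → suc (suc t) ≤ x
  far-enough t p = ≤-trans (subst (_≤ t + 3) (+-comm t 2) (+-monoʳ-≤ t (s≤s (s≤s z≤n)))) p

  isTI-prepend : ∀ x τ → isTI τ ≡ true → All (λ t → t + 3 ≤ x) τ → isTI (x ∷ τ) ≡ true
  isTI-prepend x []          _ _           = refl
  isTI-prepend x (t ∷ [])    _ (p ∷ _)     = adjOK-far x t (far-enough t p)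
  isTI-prepend x (t ∷ u ∷ r) e (p ∷ q ∷ _) =
    cong₂ _∧_ (adjOK-far x t (far-enough t p)) (cong₂ _∧_ (gapOK-far x u q) e)


  -- In a decreasing list the head is at least the next part, so it never violates a lower bound first.
  all≥-dominated : ∀ t x y r → y ≤ x → (t ≤ᵇ x) ∧ all≥ t (y ∷ r) ≡ all≥ t (y ∷ r)
  all≥-dominated t x y r y≤x with t ≤? y
  ... | yes t≤y = cong (_∧ all≥ t (y ∷ r)) (≤ᵇ-true (≤-trans t≤y y≤x))
  ... | no  t≰y = trans (cong ((t ≤ᵇ x) ∧_) (cong (_∧ all≥ t r) f)) (trans (∧-zeroʳ (t ≤ᵇ x)) (sym (cong (_∧ all≥ t r) f)))
    where
    f : (t ≤ᵇ y) ≡ false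
    f = dec-false (t ≤? y) t≰y

  ∧-rotate : ∀ a p q s → a ∧ (p ∧ (q ∧ s)) ≡ p ∧ (q ∧ (a ∧ s))
  ∧-rotate true  p q s = refl
  ∧-rotate false p q s = sym (trans (cong (p ∧_) (∧-zeroʳ q)) (∧-zeroʳ p))

  Junction : List ℕ → ℕ → Set
  Junction τ m = ∀ k l → Decreasing k l → all≥ 4 l ∧ isTI (l ++ τ) ≡ all≥ m l ∧ isTI l

  JunctionOne JunctionTwo : List ℕ → ℕ → Set
  JunctionOne τ m = ∀ x → (4 ≤ᵇ x) ∧ isTI (x ∷ τ) ≡ (m ≤ᵇ x)
  JunctionTwo τ m = ∀ x y → y ≤ x → ((4 ≤ᵇ x) ∧ (4 ≤ᵇ y)) ∧ isTI (x ∷ y ∷ τ) ≡ ((m ≤ᵇ x) ∧ (m ≤ᵇ y)) ∧ adjOK x y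

  -- T_I only looks at consecutive parts and parts two apart, so the junction of longer
  -- partitions reduces to the junction of their last two parts.
  junction-from-short : ∀ τ m → isTI τ ≡ true → JunctionOne τ m → JunctionTwo τ m → Junction τ m
  junction-from-short τ m τ-TI one two k [] _ = τ-TI
  junction-from-short τ m τ-TI one two k (x ∷ []) _ = begin
    ((4 ≤ᵇ x) ∧ true) ∧ isTI (x ∷ τ) ≡⟨ cong (_∧ isTI (x ∷ τ)) (∧-identityʳ _) ⟩
    (4 ≤ᵇ x) ∧ isTI (x ∷ τ)          ≡⟨ one x ⟩
    m ≤ᵇ x                           ≡⟨ sym (trans (∧-identityʳ _) (∧-identityʳ _)) ⟩
    ((m ≤ᵇ x) ∧ true) ∧ true         ∎
    where open ≡-Reasoning
  junction-from-short τ m τ-TI one two k (x ∷ y ∷ []) (_ , (_ , y≤x) , _) = begin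
    ((4 ≤ᵇ x) ∧ ((4 ≤ᵇ y) ∧ true)) ∧ isTI (x ∷ y ∷ τ) ≡⟨ cong (λ b → ((4 ≤ᵇ x) ∧ b) ∧ isTI (x ∷ y ∷ τ)) (∧-identityʳ _) ⟩
    ((4 ≤ᵇ x) ∧ (4 ≤ᵇ y)) ∧ isTI (x ∷ y ∷ τ)          ≡⟨ two x y y≤x ⟩
    ((m ≤ᵇ x) ∧ (m ≤ᵇ y)) ∧ adjOK x y                 ≡⟨ sym (cong (λ b → ((m ≤ᵇ x) ∧ b) ∧ adjOK x y) (∧-identityʳ _)) ⟩
    ((m ≤ᵇ x) ∧ ((m ≤ᵇ y) ∧ true)) ∧ adjOK x y        ∎
    where open ≡-Reasoning
  junction-from-short τ m τ-TI one two k (x ∷ y ∷ z ∷ r) (_ , d@((_ , y≤x) , _)) = begin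
    ((4 ≤ᵇ x) ∧ A₄) ∧ (p ∧ (q ∧ isTI (l ++ τ))) ≡⟨ cong (_∧ (p ∧ (q ∧ isTI (l ++ τ)))) (all≥-dominated 4 x y (z ∷ r) y≤x) ⟩
    A₄ ∧ (p ∧ (q ∧ isTI (l ++ τ)))             ≡⟨ ∧-rotate A₄ p q _ ⟩
    p ∧ (q ∧ (A₄ ∧ isTI (l ++ τ)))             ≡⟨ cong (λ b → p ∧ (q ∧ b)) (junction-from-short τ m τ-TI one two x (y ∷ z ∷ r) d) ⟩
    p ∧ (q ∧ (Aₘ ∧ isTI l))                    ≡⟨ sym (∧-rotate Aₘ p q _) ⟩
    Aₘ ∧ (p ∧ (q ∧ isTI l))                    ≡⟨ sym (cong (_∧ (p ∧ (q ∧ isTI l))) (all≥-dominated m x y (z ∷ r) y≤x)) ⟩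
    ((m ≤ᵇ x) ∧ Aₘ) ∧ (p ∧ (q ∧ isTI l))       ∎
    where
    open ≡-Reasoning
    l = y ∷ z ∷ r
    A₄ = all≥ 4 l
    Aₘ = all≥ m l
    p = adjOK x y
    q = gapOK x z

  -- The junction conditions for parts below 6 (one part) and below 8 and 6 (two parts);
  -- for concrete τ and m these are checked by evaluation.
  SmallCases : List ℕ → ℕ → Set
  SmallCases τ m = (∀ {x} → x < 6 → (4 ≤ᵇ x) ∧ isTI (x ∷ τ) ≡ (m ≤ᵇ x))
                 × (∀ {x} → x < 8 → ∀ {y} → y < 6 → y ≤ x →
                      ((4 ≤ᵇ x) ∧ (4 ≤ᵇ y)) ∧ isTI (x ∷ y ∷ τ) ≡ ((m ≤ᵇ x) ∧ (m ≤ᵇ y)) ∧ adjOK x y)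

  smallCases? : ∀ τ m → Dec (SmallCases τ m)
  smallCases? τ m =
    allUpTo? (λ x → ((4 ≤ᵇ x) ∧ isTI (x ∷ τ)) Bool.≟ (m ≤ᵇ x)) 6
    ×-dec allUpTo? (λ x → allUpTo? (λ y → (y ≤? x) →-dec
                     ((((4 ≤ᵇ x) ∧ (4 ≤ᵇ y)) ∧ isTI (x ∷ y ∷ τ)) Bool.≟ (((m ≤ᵇ x) ∧ (m ≤ᵇ y)) ∧ adjOK x y))) 6) 8

  -- Beyond the small
  -- cases, a part ≥ 6 is far from every part of the tail, and a part ≥ 8 is far from any
  -- part below 6, which reduces two-part lists to one-part lists.
  junction : ∀ t τ m → isTI (t ∷ τ) ≡ true → All (_≤ 3) (t ∷ τ) → m ≤ 6 → SmallCases (t ∷ τ) m → Junction (t ∷ τ) m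
  junction t τ m τ-TI τ≤3 m≤6 (small₁ , small₂) = junction-from-short (t ∷ τ) m τ-TI one two
    where
    far-from-tail : ∀ x → 6 ≤ x → All (λ s → s + 3 ≤ x) (t ∷ τ)
    far-from-tail x 6≤x = All.map (λ s≤3 → ≤-trans (+-monoˡ-≤ 3 s≤3) 6≤x) τ≤3

    prepend-large : ∀ x → 6 ≤ x → isTI (x ∷ t ∷ τ) ≡ true
    prepend-large x 6≤x = isTI-prepend x (t ∷ τ) τ-TI (far-from-tail x 6≤x)

    gap-large : ∀ x → 6 ≤ x → gapOK x t ≡ true
    gap-large x 6≤x with far-from-tail x 6≤x
    ... | t+3≤x ∷ _ = gapOK-far x t t+3≤x

    ≥4 : ∀ {x} → 6 ≤ x → 4 ≤ x
    ≥4 = ≤-trans (s≤s (s≤s (s≤s (s≤s z≤n))))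

    one : JunctionOne (t ∷ τ) m
    one x with x <? 6
    ... | yes x<6 = small₁ x<6
    ... | no  x≮6 = trans (cong₂ _∧_ (≤ᵇ-true (≥4 6≤x)) (prepend-large x 6≤x)) (sym (≤ᵇ-true (≤-trans m≤6 6≤x)))
      where 6≤x = ≮⇒≥ x≮6

    two : JunctionTwo (t ∷ τ) m
    two x y y≤x with y <? 6
    ... | no y≮6 = trans
      (cong₂ (λ a b → a ∧ (adjOK x y ∧ b)) (cong₂ _∧_ (≤ᵇ-true (≥4 6≤x)) (≤ᵇ-true (≥4 6≤y)))
                                           (cong₂ _∧_ (gap-large x 6≤x) (prepend-large y 6≤y)))
      (trans (∧-identityʳ (adjOK x y))
             (sym (cong (_∧ adjOK x y) (cong₂ _∧_ (≤ᵇ-true (≤-trans m≤6 6≤x)) (≤ᵇ-true (≤-trans m≤6 6≤y))))))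
      where
      6≤y = ≮⇒≥ y≮6
      6≤x = ≤-trans 6≤y y≤x
    ... | yes y<6 with x <? 8
    ...   | yes x<8 = small₂ x<8 y<6 y≤x
    ...   | no  x≮8 = begin
      ((4 ≤ᵇ x) ∧ (4 ≤ᵇ y)) ∧ (adjOK x y ∧ (gapOK x t ∧ isTI (y ∷ t ∷ τ)))
        ≡⟨ cong₂ (λ a b → (a ∧ (4 ≤ᵇ y)) ∧ b) (≤ᵇ-true (≥4 6≤x))
                 (cong₂ (λ a b → a ∧ (b ∧ isTI (y ∷ t ∷ τ))) (adjOK-far x y y+2≤x) (gap-large x 6≤x)) ⟩
      (4 ≤ᵇ y) ∧ isTI (y ∷ t ∷ τ)       ≡⟨ one y ⟩
      m ≤ᵇ y                            ≡⟨ sym (∧-identityʳ (m ≤ᵇ y)) ⟩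
      (m ≤ᵇ y) ∧ true                   ≡⟨ sym (cong₂ (λ a b → (a ∧ (m ≤ᵇ y)) ∧ b) (≤ᵇ-true (≤-trans m≤6 6≤x)) (adjOK-far x y y+2≤x)) ⟩
      ((m ≤ᵇ x) ∧ (m ≤ᵇ y)) ∧ adjOK x y ∎
      where
      open ≡-Reasoning
      8≤x = ≮⇒≥ x≮8
      6≤x = ≤-trans (n≤1+n 6) (≤-trans (n≤1+n 7) 8≤x)
      y+2≤x = ≤-trans (s≤s y<6) (≤-trans (n≤1+n 7) 8≤x)

  junction-by-evaluation : ∀ t τ m →
    {_ : True (((isTI (t ∷ τ) Bool.≟ true) ×-dec All.all? (_≤? 3) (t ∷ τ)) ×-dec ((m ≤? 6) ×-dec smallCases? (t ∷ τ) m))} →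
    Junction (t ∷ τ) m
  junction-by-evaluation t τ m {ok} with toWitness ok
  ... | (τ-TI , τ≤3) , (m≤6 , small) = junction t τ m τ-TI τ≤3 m≤6 small


module Tails where

  open Counting
  open TI
  open import Data.Bool using (Bool; true; false; _∧_; if_then_else_)
  open import Data.Bool.Properties using (∧-assoc; ∧-zeroʳ)
  open import Data.Nat
  open import Data.Nat.Properties
  open import Data.List using (List; []; _∷_; map; _++_; length)
  open import Data.List.Properties using (++-assoc; ++-identityʳ)
  open import Data.Product using (_,_)
  open import Relation.Nullary.Decidable using (⌊_⌋; isYes≗does)
  open import Relation.Binary.PropositionalEquality

  withTail : List ℕ → List ℕ → Bool
  withTail τ l = isTI (l ++ τ)

  tailCount : ℕ → List ℕ → ℕ → ℕ → ℕ
  tailCount t τ a n = N (Restr t (withTail τ) a) n n n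

  peeled : ℕ → List ℕ → ℕ → ℕ → ℕ
  peeled t τ zero    n = 0
  peeled t τ (suc a) n = if t ≤ᵇ n then tailCount t (t ∷ τ) a (n ∸ t) else 0

  tailCount-peel : ∀ t τ a n → 1 ≤ t → tailCount t τ a n ≡ tailCount (suc t) τ a n + peeled t τ a n
  tailCount-peel t τ a n 1≤t = begin
    tailCount t τ a n
      ≡⟨ sym (N-canonical (Restr t (withTail τ) a) n n (n + t) ≤-refl (m≤m+n n t)) ⟩
    N (Restr t (withTail τ) a) n n (n + t)
      ≡⟨ peel n n (n + t) t a (withTail τ) 1≤t (m≤n+m t n) ≤-refl ⟩
    N (Restr (suc t) (withTail τ) a) n n (n + t) + Qf n n (n + t) t a (withTail τ)
      ≡⟨ cong₂ _+_ (N-canonical (Restr (suc t) (withTail τ) a) n n (n + t) ≤-refl (m≤m+n n t)) (Qf≡peeled a) ⟩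
    tailCount (suc t) τ a n + peeled t τ a n ∎
    where
    open ≡-Reasoning
    Qf≡peeled : ∀ a → Qf n n (n + t) t a (withTail τ) ≡ peeled t τ a n
    Qf≡peeled zero    = refl
    Qf≡peeled (suc a) = cong (λ x → if t ≤ᵇ n then x else 0) (trans
      (N-cong _ _ n (n ∸ t) (n + t) (λ l _ → cong (λ l′ → all≥ t l ∧ (isTI l′ ∧ (length l ≡ᵇ a))) (++-assoc l (t ∷ []) τ)))
      (N-canonical _ n (n ∸ t) (n + t) (m∸n≤m n t) (≤-trans (m∸n≤m n t) (m≤m+n n t))))

  tailCount-dead : ∀ t τ a n → isTI τ ≡ false → tailCount t τ a n ≡ 0
  tailCount-dead t τ a n e = N-false _ n n n (λ l →
    trans (cong (λ b → all≥ t l ∧ (b ∧ (length l ≡ᵇ a))) (isTI-suffix l τ e)) (∧-zeroʳ (all≥ t l)))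

  tailCount-junction : ∀ τ m → Junction τ m → ∀ a n → tailCount 4 τ a n ≡ tailCount m [] a n
  tailCount-junction τ m J a n = N-cong _ _ n n n (λ l d → let c = length l ≡ᵇ a in begin
    all≥ 4 l ∧ (isTI (l ++ τ) ∧ c) ≡⟨ sym (∧-assoc (all≥ 4 l) _ c) ⟩
    (all≥ 4 l ∧ isTI (l ++ τ)) ∧ c ≡⟨ cong (_∧ c) (J n l d) ⟩
    (all≥ m l ∧ isTI l) ∧ c        ≡⟨ ∧-assoc (all≥ m l) _ c ⟩
    all≥ m l ∧ (isTI l ∧ c)        ≡⟨ cong (λ l′ → all≥ m l ∧ (isTI l′ ∧ c)) (sym (++-identityʳ l)) ⟩
    all≥ m l ∧ (isTI (l ++ []) ∧ c) ∎)
    where open ≡-Reasoning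

  tailCount-shift : ∀ t a n → tailCount (4 + t) [] a (3 * a + n) ≡ tailCount (suc t) [] a n
  tailCount-shift t a n = begin
    tailCount (4 + t) [] a M
      ≡⟨ sym (N-canonical _ M M (3 + M) ≤-refl (m≤n+m M 3)) ⟩
    N (Restr (4 + t) (withTail []) a) M M (3 + M)
      ≡⟨ shift 3 M a n M t (withTail []) ≤-refl ⟩
    N (Restr (suc t) (λ l → withTail [] (map (3 +_) l)) a) M n M
      ≡⟨ N-cong _ _ M n M (λ l _ → cong (λ b → all≥ (suc t) l ∧ (b ∧ (length l ≡ᵇ a))) (map3-TI l)) ⟩
    N (Restr (suc t) (withTail []) a) M n M
      ≡⟨ N-canonical _ M n M (m≤n+m n (3 * a)) (m≤n+m n (3 * a)) ⟩
    tailCount (suc t) [] a n ∎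
    where
    open ≡-Reasoning
    M = 3 * a + n
    map3-TI : ∀ l → isTI (map (3 +_) l ++ []) ≡ isTI (l ++ [])
    map3-TI l rewrite ++-identityʳ (map (3 +_) l) | ++-identityʳ l = isTI-map3 l

  -- a parts ≥ 4 + t need more than 3a.
  tailCount-small : ∀ t a n → n < 3 * a → tailCount (4 + t) [] a n ≡ 0
  tailCount-small t a n n<3a = N-too-small n (4 + t) a n n (withTail []) (<-≤-trans n<3a (*-monoˡ-≤ a (m≤m+n 3 (suc t))))

  all≥1 : ∀ k l → Decreasing k l → all≥ 1 l ≡ true
  all≥1 k []      _                 = refl
  all≥1 k (x ∷ l) ((1≤x , _) , d) = cong₂ _∧_ (≤ᵇ-true 1≤x) (all≥1 x l d)

  G-count : ∀ a n → count (λ l → isTI l ∧ ⌊ length l ≟ a ⌋) (partitions n) ≡ tailCount 1 [] a n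
  G-count a n = trans (count-partitionsBounded _ n n n) (N-cong _ _ n n n (λ l d → begin
    isTI l ∧ ⌊ length l ≟ a ⌋                   ≡⟨ cong₂ (λ l′ b → isTI l′ ∧ b) (sym (++-identityʳ l)) (isYes≗does (length l ≟ a)) ⟩
    isTI (l ++ []) ∧ (length l ≡ᵇ a)            ≡⟨ cong (_∧ (isTI (l ++ []) ∧ (length l ≡ᵇ a))) (sym (all≥1 n l d)) ⟩
    all≥ 1 l ∧ (isTI (l ++ []) ∧ (length l ≡ᵇ a)) ∎))
    where open ≡-Reasoning


-- Generating functions of partitions with a tail, as coefficient functions ℤ × ℤ → ℤ
-- (extended by 0 to negative exponents, so that multiplying by monomials and substituting
-- x ↦ x q³ are total operations on coefficients).
module Series where

  open Counting using (≤ᵇ-true; ≤ᵇ-false)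
  open TI using (Junction)
  open Tails
  open import Data.Bool using (false; _∧_; if_then_else_)
  open import Data.Bool.Properties using (if-float; if-cong)
  open import Data.Nat as ℕ using (ℕ; zero; suc; _≤ᵇ_; _∸_; _≤?_; s≤s; z≤n)
  import Data.Nat.Properties as ℕ
  open import Data.Integer as ℤ using (ℤ; +_; -[1+_]; _-_; -_; _+_; _*_)
  import Data.Integer.Properties as ℤ
  open import Data.Integer.Tactic.RingSolver using (solve-∀)
  open import Data.List using (List; []; _∷_; map; _++_)
  open import Data.List.Relation.Unary.All as All using (All; []; _∷_)
  open import Data.Product using (∃-syntax; _×_; _,_; proj₁; proj₂)
  open import Data.Product.Properties using (≡-dec)
  open import Relation.Binary.Definitions using (DecidableEquality)
  open import Relation.Nullary using (yes; no)
  open import Relation.Nullary.Decidable using (⌊_⌋; isYes≗does; True; toWitness)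
  open import Relation.Binary.PropositionalEquality

  extend : (ℕ → ℕ → ℕ) → ℤ → ℤ → ℤ
  extend F (+ a)     (+ b)     = + F a b
  extend F (+ a)     -[1+ b ]  = + 0
  extend F -[1+ a ]  B         = + 0

  extend-neg : ∀ F A b → extend F A -[1+ b ] ≡ + 0
  extend-neg F (+ a)    b = refl
  extend-neg F -[1+ a ] b = refl

  sub-pos : ∀ a i → i ℕ.≤ a → + a - + i ≡ + (a ∸ i)
  sub-pos a i i≤a = trans (ℤ.m-n≡m⊖n a i) (ℤ.⊖-≥ i≤a)

  sub-neg : ∀ a i → a ℕ.< i → ∃[ d ] (+ a - + i ≡ -[1+ d ])
  sub-neg a (suc i) (s≤s a≤i) = i ∸ a ,
    trans (ℤ.m-n≡m⊖n a (suc i)) (trans (ℤ.⊖-< (s≤s a≤i)) (cong (λ z → - (+ z)) (ℕ.+-∸-assoc 1 a≤i)))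

  extend-sub : ∀ F a b j → extend F (+ a) (+ b - + j) ≡ (if j ≤ᵇ b then + F a (b ∸ j) else + 0)
  extend-sub F a b j with j ≤? b
  ... | yes j≤b rewrite sub-pos b j j≤b | ≤ᵇ-true j≤b = refl
  ... | no  j≰b rewrite ≤ᵇ-false (ℕ.≰⇒> j≰b) with sub-neg b j (ℕ.≰⇒> j≰b)
  ...   | d , e rewrite e = refl

  𝔾 : ℕ → List ℕ → ℤ → ℤ → ℤ
  𝔾 t τ = extend (tailCount t τ)

  -- G_{t,τ} = G_{t+1,τ} + x q^t G_{t,(t)τ}: the smallest part either exceeds t or equals t.
  𝔾-peel : ∀ t τ A B → 𝔾 (suc t) τ A B ≡ 𝔾 (suc (suc t)) τ A B + 𝔾 (suc t) (suc t ∷ τ) (A - + 1) (B - + suc t)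
  𝔾-peel t τ -[1+ a ] B          = refl
  𝔾-peel t τ (+ a)    -[1+ b ]   = sym (trans (ℤ.+-identityˡ _) (extend-neg _ (+ a - + 1) (suc (b ℕ.+ t))))
  𝔾-peel t τ (+ a)    (+ b)      =
    trans (cong +_ (tailCount-peel (suc t) τ a b (s≤s z≤n))) (cong (λ z → + tailCount (suc (suc t)) τ a b + z) (peeled≡ a))
    where
    peeled≡ : ∀ a → + peeled (suc t) τ a b ≡ 𝔾 (suc t) (suc t ∷ τ) (+ a - + 1) (+ b - + suc t)
    peeled≡ zero    = refl
    peeled≡ (suc a) = trans (if-float +_ (suc t ≤ᵇ b)) (sym (extend-sub _ a b (suc t)))

  𝔾-dead : ∀ t τ → isTI τ ≡ false → ∀ A B → 𝔾 t τ A B ≡ + 0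
  𝔾-dead t τ e (+ a)    (+ b)    = cong +_ (tailCount-dead t τ a b e)
  𝔾-dead t τ e (+ a)    -[1+ b ] = refl
  𝔾-dead t τ e -[1+ a ] B        = refl

  𝔾-junction : ∀ τ m → Junction τ m → ∀ A B → 𝔾 4 τ A B ≡ 𝔾 m [] A B
  𝔾-junction τ m J (+ a)    (+ b)    = cong +_ (tailCount-junction τ m J a b)
  𝔾-junction τ m J (+ a)    -[1+ b ] = refl
  𝔾-junction τ m J -[1+ a ] B        = refl

  𝔾-shift : ∀ t A B → 𝔾 (4 ℕ.+ t) [] A B ≡ 𝔾 (suc t) [] A (B - + 3 * A)
  𝔾-shift t -[1+ a ] B = refl
  𝔾-shift t (+ a)    B rewrite sym (ℤ.pos-* 3 a) = shifted B
    where
    shifted : ∀ B → 𝔾 (4 ℕ.+ t) [] (+ a) B ≡ 𝔾 (suc t) [] (+ a) (B - + (3 ℕ.* a))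
    shifted -[1+ b ] with 3 ℕ.* a
    ... | zero  = refl
    ... | suc m = refl
    shifted (+ b) with 3 ℕ.* a ≤? b
    ... | yes 3a≤b = trans
      (cong +_ (trans (cong (tailCount (4 ℕ.+ t) [] a) (sym (ℕ.m+[n∸m]≡n 3a≤b))) (tailCount-shift t a (b ∸ 3 ℕ.* a))))
      (sym (trans (extend-sub _ a b (3 ℕ.* a)) (if-cong (≤ᵇ-true 3a≤b))))
    ... | no  3a≰b = trans
      (cong +_ (tailCount-small t a b (ℕ.≰⇒> 3a≰b)))
      (sym (trans (extend-sub _ a b (3 ℕ.* a)) (if-cong (≤ᵇ-false (ℕ.≰⇒> 3a≰b)))))

  -- A key (f , i , j , k) stands for the series  x^i q^j G_f(x q^k).
  Key : Set
  Key = ℕ × ℕ × ℕ × ℕ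

  atom : Key → ℤ → ℤ → ℤ
  atom (f , i , j , k) A B = 𝔾 f [] (A - + i) (B - + j - + k * (A - + i))

  sub-sub : ∀ A m n → A - + m - + n ≡ A - + (m ℕ.+ n)
  sub-sub A m n = begin
    A - + m - + n         ≡⟨ ℤ.+-assoc A (- + m) (- + n) ⟩
    A + (- + m + - + n)   ≡⟨ cong (λ z → A + z) (sym (ℤ.neg-distrib-+ (+ m) (+ n))) ⟩
    A - (+ m + + n)       ≡⟨ cong (λ z → A - z) (sym (ℤ.pos-+ m n)) ⟩
    A - + (m ℕ.+ n)       ∎
    where open ≡-Reasoning

  atom-plain : ∀ f A B → atom (f , 0 , 0 , 0) A B ≡ 𝔾 f [] A B
  atom-plain f A B = cong₂ (𝔾 f []) (ℤ.+-identityʳ A) (trans (ℤ.+-identityʳ _) (ℤ.+-identityʳ B))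

  atom-shifted : ∀ f i j A B A′ B′ → A′ ≡ A - + i → B′ ≡ B - + j → 𝔾 f [] A′ (B′ - + 3 * A′) ≡ atom (f , i , j , 3) A B
  atom-shifted f i j A B _ _ refl refl = refl

  Combination : Set
  Combination = List (ℤ × Key)

  eval : Combination → ℤ → ℤ → ℤ
  eval []              A B = + 0
  eval ((c , key) ∷ ts) A B = c * atom key A B + eval ts A B

  Relation : Combination → Set
  Relation ts = ∀ A B → eval ts A B ≡ + 0

  eval-++ : ∀ ts us A B → eval (ts ++ us) A B ≡ eval ts A B + eval us A B
  eval-++ []              us A B = sym (ℤ.+-identityˡ _)
  eval-++ ((c , key) ∷ ts) us A B =
    trans (cong (λ z → c * atom key A B + z) (eval-++ ts us A B)) (sym (ℤ.+-assoc (c * atom key A B) _ _))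

  Relation-++ : ∀ ts us → Relation ts → Relation us → Relation (ts ++ us)
  Relation-++ ts us r s A B = trans (eval-++ ts us A B) (cong₂ _+_ (r A B) (s A B))

  scale : ℤ → ℕ → ℕ → Combination → Combination
  scale c₀ i₀ j₀ = map (λ { (c , f , i , j , k) → (c₀ * c , f , i₀ ℕ.+ i , j₀ ℕ.+ j , k) })

  eval-scale : ∀ c₀ i₀ j₀ ts A B → eval (scale c₀ i₀ j₀ ts) A B ≡ c₀ * eval ts (A - + i₀) (B - + j₀)
  eval-scale c₀ i₀ j₀ []                      A B = sym (ℤ.*-zeroʳ c₀)
  eval-scale c₀ i₀ j₀ ((c , f , i , j , k) ∷ ts) A B =
    trans (cong₂ _+_ term (eval-scale c₀ i₀ j₀ ts A B)) (sym (ℤ.*-distribˡ-+ c₀ _ _))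
    where
    term : (c₀ * c) * atom (f , i₀ ℕ.+ i , j₀ ℕ.+ j , k) A B ≡ c₀ * (c * atom (f , i , j , k) (A - + i₀) (B - + j₀))
    term rewrite sym (sub-sub A i₀ i) | sym (sub-sub B j₀ j) = ℤ.*-assoc c₀ c _

  Relation-scale : ∀ c₀ i₀ j₀ ts → Relation ts → Relation (scale c₀ i₀ j₀ ts)
  Relation-scale c₀ i₀ j₀ ts r A B = trans (eval-scale c₀ i₀ j₀ ts A B) (trans (cong (c₀ *_) (r _ _)) (ℤ.*-zeroʳ c₀))

  negate : Combination → Combination
  negate = scale -[1+ 0 ] 0 0

  -- the substitution  x ↦ x q³
  subst3 : Combination → Combination
  subst3 = map (λ { (c , f , i , j , k) → (c , f , i , j ℕ.+ 3 ℕ.* i , k ℕ.+ 3) })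

  eval-subst3 : ∀ ts A B → eval (subst3 ts) A B ≡ eval ts A (B - + 3 * A)
  eval-subst3 []                      A B = refl
  eval-subst3 ((c , f , i , j , k) ∷ ts) A B =
    cong₂ _+_ (cong (λ z → c * 𝔾 f [] (A - + i) z) exponent) (eval-subst3 ts A B)
    where
    regroup : ∀ (A B I J K : ℤ) → B - (J + + 3 * I) - (K + + 3) * (A - I) ≡ (B - + 3 * A) - J - K * (A - I)
    regroup = solve-∀
    exponent : B - + (j ℕ.+ 3 ℕ.* i) - + (k ℕ.+ 3) * (A - + i) ≡ (B - + 3 * A) - + j - + k * (A - + i)
    exponent = trans
      (cong₂ (λ x y → B - x - y * (A - + i)) (trans (ℤ.pos-+ j (3 ℕ.* i)) (cong (λ z → + j + z) (ℤ.pos-* 3 i))) (ℤ.pos-+ k 3))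
      (regroup A B (+ i) (+ j) (+ k))

  Relation-subst3 : ∀ ts → Relation ts → Relation (subst3 ts)
  Relation-subst3 ts r A B = trans (eval-subst3 ts A B) (r A (B - + 3 * A))

  times : Poly → Combination → Combination
  times []              ts = []
  times ((c , i , j) ∷ P) ts = scale c i j ts ++ times P ts

  Relation-times : ∀ P ts → Relation ts → Relation (times P ts)
  Relation-times []              ts r A B = refl
  Relation-times ((c , i , j) ∷ P) ts r =
    Relation-++ (scale c i j ts) (times P ts) (Relation-scale c i j ts r) (Relation-times P ts r)

  _≟-key_ : DecidableEquality Key
  _≟-key_ = ≡-dec ℕ._≟_ (≡-dec ℕ._≟_ (≡-dec ℕ._≟_ ℕ._≟_))

  insert : ℤ × Key → Combination → Combination
  insert (c , key) []                = (c , key) ∷ []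
  insert (c , key) ((c′ , key′) ∷ ts) with key ≟-key key′
  ... | yes _ = (c + c′ , key′) ∷ ts
  ... | no  _ = (c′ , key′) ∷ insert (c , key) ts

  normalize : Combination → Combination
  normalize []       = []
  normalize (t ∷ ts) = insert t (normalize ts)

  eval-insert : ∀ c key ts A B → eval (insert (c , key) ts) A B ≡ c * atom key A B + eval ts A B
  eval-insert c key []                A B = refl
  eval-insert c key ((c′ , key′) ∷ ts) A B with key ≟-key key′
  ... | yes refl = collect c c′ (atom key A B) (eval ts A B)
    where
    collect : ∀ (c c′ X R : ℤ) → (c + c′) * X + R ≡ c * X + (c′ * X + R)
    collect = solve-∀
  ... | no  _    = trans (cong (λ z → c′ * atom key′ A B + z) (eval-insert c key ts A B))
                         (exchange c (atom key A B) c′ (atom key′ A B) (eval ts A B))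
    where
    exchange : ∀ (c X c′ X′ R : ℤ) → c′ * X′ + (c * X + R) ≡ c * X + (c′ * X′ + R)
    exchange = solve-∀

  eval-normalize : ∀ ts A B → eval (normalize ts) A B ≡ eval ts A B
  eval-normalize []              A B = refl
  eval-normalize ((c , key) ∷ ts) A B =
    trans (eval-insert c key (normalize ts) A B) (cong (λ z → c * atom key A B + z) (eval-normalize ts A B))

  zero-coefficients : ∀ ts → All (λ t → proj₁ t ≡ + 0) ts → Relation ts
  zero-coefficients []              []         A B = refl
  zero-coefficients ((c , key) ∷ ts) (refl ∷ z) A B = trans (ℤ.+-identityˡ _) (zero-coefficients ts z A B)

  relation-by-normalization : ∀ ts → {_ : True (All.all? (λ t → proj₁ t ℤ.≟ + 0) (normalize ts))} → Relation ts
  relation-by-normalization ts {ok} A B =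
    trans (sym (eval-normalize ts A B)) (zero-coefficients (normalize ts) (toWitness ok) A B)

  J-1 : Junction (1 ∷ []) 4
  J-1 = TI.junction-by-evaluation 1 [] 4
  J-2 : Junction (2 ∷ []) 4
  J-2 = TI.junction-by-evaluation 2 [] 4
  J-21 : Junction (2 ∷ 1 ∷ []) 4
  J-21 = TI.junction-by-evaluation 2 (1 ∷ []) 4
  J-3 : Junction (3 ∷ []) 5
  J-3 = TI.junction-by-evaluation 3 [] 5
  J-31 : Junction (3 ∷ 1 ∷ []) 5
  J-31 = TI.junction-by-evaluation 3 (1 ∷ []) 5
  J-33 : Junction (3 ∷ 3 ∷ []) 6
  J-33 = TI.junction-by-evaluation 3 (3 ∷ []) 6

  Gq : ℕ → ℤ → ℤ → ℤ
  Gq f A B = 𝔾 f [] A (B - + 3 * A)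

  -- A smallest part t that would make the tail non-T_I cannot occur.
  𝔾-peel-dead : ∀ t τ → isTI (suc t ∷ τ) ≡ false → ∀ A B → 𝔾 (suc t) τ A B ≡ 𝔾 (suc (suc t)) τ A B
  𝔾-peel-dead t τ e A B = trans (𝔾-peel t τ A B)
    (trans (cong (λ z → 𝔾 (suc (suc t)) τ A B + z) (𝔾-dead (suc t) (suc t ∷ τ) e _ _)) (ℤ.+-identityʳ _))

  𝔾-junction-shift : ∀ τ s → Junction τ (4 ℕ.+ s) → ∀ A B → 𝔾 4 τ A B ≡ Gq (suc s) A B
  𝔾-junction-shift τ s J A B = trans (𝔾-junction τ (4 ℕ.+ s) J A B) (𝔾-shift s A B)

  tail-33 : ∀ A B → 𝔾 3 (3 ∷ 3 ∷ []) A B ≡ Gq 3 A B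
  tail-33 A B = trans (𝔾-peel-dead 2 (3 ∷ 3 ∷ []) refl A B) (𝔾-junction-shift (3 ∷ 3 ∷ []) 2 J-33 A B)

  tail-31 : ∀ A B → 𝔾 3 (3 ∷ 1 ∷ []) A B ≡ Gq 2 A B
  tail-31 A B = trans (𝔾-peel-dead 2 (3 ∷ 1 ∷ []) refl A B) (𝔾-junction-shift (3 ∷ 1 ∷ []) 1 J-31 A B)

  tail-21 : ∀ A B → 𝔾 2 (2 ∷ 1 ∷ []) A B ≡ Gq 1 A B
  tail-21 A B = trans (𝔾-peel-dead 1 (2 ∷ 1 ∷ []) refl A B)
    (trans (𝔾-peel-dead 2 (2 ∷ 1 ∷ []) refl A B) (𝔾-junction-shift (2 ∷ 1 ∷ []) 0 J-21 A B))

  tail-2 : ∀ A B → 𝔾 2 (2 ∷ []) A B ≡ Gq 1 A B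
  tail-2 A B = trans (𝔾-peel-dead 1 (2 ∷ []) refl A B)
    (trans (𝔾-peel-dead 2 (2 ∷ []) refl A B) (𝔾-junction-shift (2 ∷ []) 0 J-2 A B))

  tail-3 : ∀ A B → 𝔾 3 (3 ∷ []) A B ≡ Gq 2 A B + Gq 3 (A - + 1) (B - + 3)
  tail-3 A B = trans (𝔾-peel 2 (3 ∷ []) A B)
    (cong₂ _+_ (𝔾-junction-shift (3 ∷ []) 1 J-3 A B) (tail-33 (A - + 1) (B - + 3)))

  tail-1 : ∀ A B → 𝔾 1 (1 ∷ []) A B ≡ (Gq 1 A B + Gq 2 (A - + 1) (B - + 3)) + Gq 1 (A - + 1) (B - + 2)
  tail-1 A B = begin
    𝔾 1 (1 ∷ []) A B
      ≡⟨ 𝔾-peel-dead 0 (1 ∷ []) refl A B ⟩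
    𝔾 2 (1 ∷ []) A B
      ≡⟨ 𝔾-peel 1 (1 ∷ []) A B ⟩
    𝔾 3 (1 ∷ []) A B + 𝔾 2 (2 ∷ 1 ∷ []) (A - + 1) (B - + 2)
      ≡⟨ cong₂ _+_ (𝔾-peel 2 (1 ∷ []) A B) (tail-21 (A - + 1) (B - + 2)) ⟩
    (𝔾 4 (1 ∷ []) A B + 𝔾 3 (3 ∷ 1 ∷ []) (A - + 1) (B - + 3)) + Gq 1 (A - + 1) (B - + 2)
      ≡⟨ cong (_+ Gq 1 (A - + 1) (B - + 2)) (cong₂ _+_ (𝔾-junction-shift (1 ∷ []) 0 J-1 A B) (tail-31 (A - + 1) (B - + 3))) ⟩
    (Gq 1 A B + Gq 2 (A - + 1) (B - + 3)) + Gq 1 (A - + 1) (B - + 2) ∎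
    where open ≡-Reasoning

  Σℤ : List ℤ → ℤ
  Σℤ []       = + 0
  Σℤ (x ∷ xs) = x + Σℤ xs

  defining : Key → List Key → Combination
  defining h ks = (+ 1 , h) ∷ map (λ k → (-[1+ 0 ] , k)) ks

  defining-relation : ∀ h ks → (∀ A B → atom h A B ≡ Σℤ (map (λ k → atom k A B) ks)) → Relation (defining h ks)
  defining-relation h ks eq A B = begin
    + 1 * atom h A B + eval (map (λ k → (-[1+ 0 ] , k)) ks) A B ≡⟨ cong₂ _+_ (ℤ.*-identityˡ (atom h A B)) (eval-negated ks) ⟩
    atom h A B - Σℤ (map (λ k → atom k A B) ks)                  ≡⟨ cong (λ z → z - Σℤ (map (λ k → atom k A B) ks)) (eq A B) ⟩
    Σℤ (map (λ k → atom k A B) ks) - Σℤ (map (λ k → atom k A B) ks) ≡⟨ ℤ.+-inverseʳ (Σℤ (map (λ k → atom k A B) ks)) ⟩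
    + 0 ∎
    where
    open ≡-Reasoning
    eval-negated : ∀ ks → eval (map (λ k → (-[1+ 0 ] , k)) ks) A B ≡ - Σℤ (map (λ k → atom k A B) ks)
    eval-negated []       = refl
    eval-negated (k ∷ ks) = trans (cong₂ _+_ (ℤ.-1*i≡-i (atom k A B)) (eval-negated ks))
                                  (sym (ℤ.neg-distrib-+ (atom k A B) (Σℤ (map (λ k → atom k A B) ks))))

  G₃-keys : List Key
  G₃-keys = (1 , 0 , 0 , 3) ∷ (2 , 1 , 3 , 3) ∷ (3 , 2 , 6 , 3) ∷ []

  G₃-equation : ∀ A B → atom (3 , 0 , 0 , 0) A B ≡ Σℤ (map (λ k → atom k A B) G₃-keys)
  G₃-equation A B = begin
    atom (3 , 0 , 0 , 0) A B                       ≡⟨ atom-plain 3 A B ⟩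
    𝔾 3 [] A B                                     ≡⟨ 𝔾-peel 2 [] A B ⟩
    𝔾 4 [] A B + 𝔾 3 (3 ∷ []) A₁ B₁                ≡⟨ cong₂ _+_ (𝔾-shift 0 A B) (tail-3 A₁ B₁) ⟩
    Gq 1 A B + (Gq 2 A₁ B₁ + Gq 3 (A₁ - + 1) (B₁ - + 3))
      ≡⟨ cong₂ _+_ (atom-shifted 1 0 0 A B A B (sym (ℤ.+-identityʳ A)) (sym (ℤ.+-identityʳ B)))
           (cong₂ _+_ (atom-shifted 2 1 3 A B A₁ B₁ refl refl)
                      (trans (atom-shifted 3 2 6 A B _ _ (sub-sub A 1 1) (sub-sub B 3 3)) (sym (ℤ.+-identityʳ _)))) ⟩
    Σℤ (map (λ k → atom k A B) G₃-keys)            ∎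
    where
    open ≡-Reasoning
    A₁ = A - + 1
    B₁ = B - + 3

  G₂-keys : List Key
  G₂-keys = (3 , 0 , 0 , 0) ∷ (1 , 1 , 2 , 3) ∷ []

  G₂-equation : ∀ A B → atom (2 , 0 , 0 , 0) A B ≡ Σℤ (map (λ k → atom k A B) G₂-keys)
  G₂-equation A B = begin
    atom (2 , 0 , 0 , 0) A B                       ≡⟨ atom-plain 2 A B ⟩
    𝔾 2 [] A B                                     ≡⟨ 𝔾-peel 1 [] A B ⟩
    𝔾 3 [] A B + 𝔾 2 (2 ∷ []) (A - + 1) (B - + 2)  ≡⟨ cong₂ _+_ (sym (atom-plain 3 A B))
                                                        (trans (tail-2 (A - + 1) (B - + 2))
                                                               (trans (atom-shifted 1 1 2 A B _ _ refl refl) (sym (ℤ.+-identityʳ _)))) ⟩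
    Σℤ (map (λ k → atom k A B) G₂-keys)            ∎
    where open ≡-Reasoning

  G₁-keys : List Key
  G₁-keys = (2 , 0 , 0 , 0) ∷ (1 , 1 , 1 , 3) ∷ (1 , 2 , 3 , 3) ∷ (2 , 2 , 4 , 3) ∷ []

  G₁-equation : ∀ A B → atom (1 , 0 , 0 , 0) A B ≡ Σℤ (map (λ k → atom k A B) G₁-keys)
  G₁-equation A B = begin
    atom (1 , 0 , 0 , 0) A B                       ≡⟨ atom-plain 1 A B ⟩
    𝔾 1 [] A B                                     ≡⟨ 𝔾-peel 0 [] A B ⟩
    𝔾 2 [] A B + 𝔾 1 (1 ∷ []) A₁ B₁                ≡⟨ cong (λ z → 𝔾 2 [] A B + z) (tail-1 A₁ B₁) ⟩
    𝔾 2 [] A B + ((Gq 1 A₁ B₁ + Gq 2 (A₁ - + 1) (B₁ - + 3)) + Gq 1 (A₁ - + 1) (B₁ - + 2))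
      ≡⟨ reorder (𝔾 2 [] A B) (Gq 1 A₁ B₁) (Gq 1 (A₁ - + 1) (B₁ - + 2)) (Gq 2 (A₁ - + 1) (B₁ - + 3)) ⟩
    𝔾 2 [] A B + (Gq 1 A₁ B₁ + (Gq 1 (A₁ - + 1) (B₁ - + 2) + (Gq 2 (A₁ - + 1) (B₁ - + 3) + + 0)))
      ≡⟨ cong₂ _+_ (sym (atom-plain 2 A B))
           (cong₂ _+_ (atom-shifted 1 1 1 A B A₁ B₁ refl refl)
             (cong₂ _+_ (atom-shifted 1 2 3 A B _ _ (sub-sub A 1 1) (sub-sub B 1 2))
                        (cong (_+ + 0) (atom-shifted 2 2 4 A B _ _ (sub-sub A 1 1) (sub-sub B 1 3))))) ⟩
    Σℤ (map (λ k → atom k A B) G₁-keys)            ∎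
    where
    open ≡-Reasoning
    A₁ = A - + 1
    B₁ = B - + 1
    reorder : ∀ (g x y z : ℤ) → g + ((x + z) + y) ≡ g + (x + (y + (z + + 0)))
    reorder = solve-∀

  G₁-relation : Relation (defining (1 , 0 , 0 , 0) G₁-keys)
  G₁-relation = defining-relation (1 , 0 , 0 , 0) G₁-keys G₁-equation
  G₂-relation : Relation (defining (2 , 0 , 0 , 0) G₂-keys)
  G₂-relation = defining-relation (2 , 0 , 0 , 0) G₂-keys G₂-equation
  G₃-relation : Relation (defining (3 , 0 , 0 , 0) G₃-keys)
  G₃-relation = defining-relation (3 , 0 , 0 , 0) G₃-keys G₃-equation

  -- Eliminating G₃: the relations expressing G₁(x) and G₂(x) through
  -- G₁(xq³), G₂(xq³) and G₁(xq⁶), namely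
  --   G₁(x) = (1 + xq + xq² + x²q³) G₁(xq³) + (xq³ + x²q⁴ + x²q⁶) G₂(xq³) - x³q¹¹ G₁(xq⁶),
  --   G₂(x) = (1 + xq²) G₁(xq³) + (xq³ + x²q⁶) G₂(xq³) - x³q¹¹ G₁(xq⁶).
  G₁-elimination G₂-elimination : Combination
  G₁-elimination = defining (1 , 0 , 0 , 0) G₁-keys ++ G₂-elimination
  G₂-elimination = defining (2 , 0 , 0 , 0) G₂-keys ++ defining (3 , 0 , 0 , 0) G₃-keys
                   ++ scale -[1+ 0 ] 2 6 (subst3 (defining (2 , 0 , 0 , 0) G₂-keys))

  G₂-elimination-relation : Relation G₂-elimination
  G₂-elimination-relation = Relation-++ D₂ (D₃ ++ correction) G₂-relation (Relation-++ D₃ correction G₃-relation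
    (Relation-scale -[1+ 0 ] 2 6 (subst3 D₂) (Relation-subst3 D₂ G₂-relation)))
    where
    D₂ D₃ correction : Combination
    D₂ = defining (2 , 0 , 0 , 0) G₂-keys
    D₃ = defining (3 , 0 , 0 , 0) G₃-keys
    correction = scale -[1+ 0 ] 2 6 (subst3 D₂)

  G₁-elimination-relation : Relation G₁-elimination
  G₁-elimination-relation = Relation-++ (defining (1 , 0 , 0 , 0) G₁-keys) G₂-elimination G₁-relation G₂-elimination-relation

  w : Poly
  w = (+ 1 , 1 , 3) ∷ (+ 1 , 2 , 4) ∷ (+ 1 , 2 , 6) ∷ []

  u : Poly
  u = (+ 1 , 0 , 0) ∷ (+ 1 , 1 , 6) ∷ []

  -- Eliminating G₂: with S the substitution x ↦ xq³,
  --   p₀ · (G₁-elimination) + w p₀ · S(G₂-elimination) - w u · S(G₁-elimination)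
  -- is the relation of the theorem.
  certificate : Combination
  certificate = times p₀ G₁-elimination ++ times w (times p₀ (subst3 G₂-elimination))
                ++ negate (times w (times u (subst3 G₁-elimination)))

  certificate-relation : Relation certificate
  certificate-relation =
    Relation-++ first (second ++ third) (Relation-times p₀ G₁-elimination G₁-elimination-relation)
      (Relation-++ second third
        (Relation-times w (times p₀ (subst3 G₂-elimination))
          (Relation-times p₀ (subst3 G₂-elimination) (Relation-subst3 G₂-elimination G₂-elimination-relation)))
        (Relation-scale -[1+ 0 ] 0 0 (times w (times u (subst3 G₁-elimination)))
          (Relation-times w (times u (subst3 G₁-elimination))
            (Relation-times u (subst3 G₁-elimination) (Relation-subst3 G₁-elimination G₁-elimination-relation)))))
    where
    first second third : Combination
    first  = times p₀ G₁-elimination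
    second = times w (times p₀ (subst3 G₂-elimination))
    third  = negate (times w (times u (subst3 G₁-elimination)))

  lift : ℕ → Poly → Combination
  lift k = map (λ { (c , i , j) → (c , 1 , i , j , k) })

  theorem-combination : Combination
  theorem-combination = lift 0 p₀ ++ lift 3 p₃ ++ lift 6 p₆ ++ lift 9 p₉

  difference-relation : Relation (theorem-combination ++ negate certificate)
  difference-relation = relation-by-normalization (theorem-combination ++ negate certificate)

  theorem-relation : Relation theorem-combination
  theorem-relation A B = begin
    eval theorem-combination A B                                    ≡⟨ sym (ℤ.+-identityʳ _) ⟩
    eval theorem-combination A B + + 0                              ≡⟨ cong (λ z → eval theorem-combination A B + z)
                                                                         (sym (Relation-scale -[1+ 0 ] 0 0 certificate certificate-relation A B)) ⟩
    eval theorem-combination A B + eval (negate certificate) A B    ≡⟨ sym (eval-++ theorem-combination (negate certificate) A B) ⟩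
    eval (theorem-combination ++ negate certificate) A B            ≡⟨ difference-relation A B ⟩
    + 0                                                             ∎
    where open ≡-Reasoning

  G≡𝔾₁ : ∀ a b → G a b ≡ 𝔾 1 [] (+ a) (+ b)
  G≡𝔾₁ a b = cong +_ (G-count a b)

  term-coefficient : ∀ c i j k a b →
    (if ⌊ i ≤? a ⌋ ∧ ⌊ j ≤? b ⌋ then c * subst-xq^ k G (a ∸ i) (b ∸ j) else + 0) ≡ c * atom (1 , i , j , k) (+ a) (+ b)
  term-coefficient c i j k a b with i ≤? a | j ≤? b
  ... | no i≰a | _ rewrite proj₂ (sub-neg a i (ℕ.≰⇒> i≰a)) = sym (ℤ.*-zeroʳ c)
  ... | yes i≤a | no j≰b rewrite sub-pos a i i≤a | proj₂ (sub-neg b j (ℕ.≰⇒> j≰b)) | sym (ℤ.pos-* k (a ∸ i)) =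
    sym (trans (cong (c *_) (negative-minus _ (proj₁ (sub-neg b j (ℕ.≰⇒> j≰b))) (k ℕ.* (a ∸ i)))) (ℤ.*-zeroʳ c))
    where
    negative-minus : ∀ A d m → 𝔾 1 [] A (-[1+ d ] - + m) ≡ + 0
    negative-minus A d zero    = extend-neg _ A d
    negative-minus A d (suc m) = extend-neg _ A (suc (d ℕ.+ m))
  ... | yes i≤a | yes j≤b rewrite sub-pos a i i≤a | sub-pos b j j≤b | sym (ℤ.pos-* k (a ∸ i)) =
    cong (c *_) (trans
      (cong₂ (λ e z → if e then z else + 0) (isYes≗does (k ℕ.* (a ∸ i) ≤? b ∸ j)) (G≡𝔾₁ (a ∸ i) (b ∸ j ∸ k ℕ.* (a ∸ i))))
      (sym (extend-sub _ (a ∸ i) (b ∸ j) (k ℕ.* (a ∸ i)))))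

  ⊙-lift : ∀ P k a b → (P ⊙ subst-xq^ k G) a b ≡ eval (lift k P) (+ a) (+ b)
  ⊙-lift []              k a b = refl
  ⊙-lift ((c , i , j) ∷ P) k a b = cong₂ _+_ (term-coefficient c i j k a b) (⊙-lift P k a b)

  LHS≡eval : ∀ a b → LHS a b ≡ eval theorem-combination (+ a) (+ b)
  LHS≡eval a b = begin
    LHS a b
      ≡⟨ cong₂ _+_ (cong₂ _+_ (cong₂ _+_ (⊙-lift p₀ 0 a b) (⊙-lift p₃ 3 a b)) (⊙-lift p₆ 6 a b)) (⊙-lift p₉ 9 a b) ⟩
    ((X₀ + X₃) + X₆) + X₉           ≡⟨ reassociate X₀ X₃ X₆ X₉ ⟩
    X₀ + (X₃ + (X₆ + X₉))           ≡⟨ sym (split (lift 0 p₀) (lift 3 p₃ ++ lift 6 p₆ ++ lift 9 p₉)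
                                              (split (lift 3 p₃) (lift 6 p₆ ++ lift 9 p₉) (split (lift 6 p₆) (lift 9 p₉) refl))) ⟩
    eval theorem-combination A B    ∎
    where
    open ≡-Reasoning
    A = + a
    B = + b
    X₀ = eval (lift 0 p₀) A B
    X₃ = eval (lift 3 p₃) A B
    X₆ = eval (lift 6 p₆) A B
    X₉ = eval (lift 9 p₉) A B
    reassociate : ∀ (w x y z : ℤ) → ((w + x) + y) + z ≡ w + (x + (y + z))
    reassociate = solve-∀
    split : ∀ ts us {r} → eval us A B ≡ r → eval (ts ++ us) A B ≡ eval ts A B + r
    split ts us e = trans (eval-++ ts us A B) (cong (λ z → eval ts A B + z) e)


open import Data.Nat using (ℕ)
open import Data.Integer using (+_)
open import Relation.Binary.PropositionalEquality using (_≡_; trans)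

mainTheorem6 : (a b : ℕ) → LHS a b ≡ + 0
mainTheorem6 a b = trans (Series.LHS≡eval a b) (Series.theorem-relation (+ a) (+ b))
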